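{- For every $\varepsilon>0$ there exists an integer $C(\varepsilon)\ge 3$ such that for all integers $d\ge C(\varepsilon)$ and $N\ge C(\varepsilon)d$ we have \[ \frac{1}{\#\Omega}\cdot\#\left\{(\mathbf v,\mathbf w)\in\Omega:\ \operatorname{dist}_d(\mathbf v,\mathbf w)\in\left[\tfrac{1}{\sqrt6}-\varepsilon,\ \tfrac{1}{\sqrt6}+\varepsilon\right]\right\}\ \ge\ 1-\varepsilon . \]
   Context: For integers $d,N\ge1$ let $\mathcal W=[0,N]^d\cap\mathbb Z^d$. For $\mathbf v=(v_1,\dots,v_d),\mathbf w=(w_1,\dots,w_d)\in\mathcal W$, the normalized distance is $\operatorname{dist}_d(\mathbf v,\mathbf w)=\frac{1}{N d^{1/2}}\big(\sum_{n=1}^d (w_n-v_n)^2\big)^{1/2}$. Two points are visible from each other if $\gcd(v_1-w_1,\dots,v_d-w_d)=1$, and $\Omega\subset\mathcal W\times\mathcal W$ is the set of ordered pairs $(\mathbf v,\mathbf w)$ of points visible from each other.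
   Formalization: The parameter ε ranges over the positive rationals. -}

module Defs where

open import Data.Nat as ℕ using (ℕ; zero; suc; ∣_-_∣)
open import Data.Nat.GCD using (gcd)
open import Data.Integer using (+_)
open import Data.Rational using (ℚ; _/_; _+_; _-_; _*_; _≤_; _<_; 0ℚ)
open import Data.Rational.Properties using (_≤?_; _<?_)
open import Data.List using (List; []; _∷_; [_]; map; concatMap; upTo; cartesianProduct; filter; length; foldr; zipWith)
open import Data.Nat.ListAction using (sum)
open import Data.Vec using (Vec; toList) renaming ([] to []ᵥ; _∷_ to _∷ᵥ_)
open import Data.Product using (_×_; _,_)
open import Data.Sum using (_⊎_)
open import Relation.Nullary using (Dec)
open import Relation.Nullary.Decidable using (_⊎-dec_)
open import Relation.Binary.PropositionalEquality using (_≡_)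

ℕ→ℚ : ℕ → ℚ
ℕ→ℚ n = + n / 1

-- The grid 𝒲 = [0,N]^d ∩ ℤ^d, listed (without repetition) as vectors of naturals.
grid : (d N : ℕ) → List (Vec ℕ d)
grid zero    N = [ []ᵥ ]
grid (suc d) N = concatMap (λ x → map (x ∷ᵥ_) (grid d N)) (upTo (suc N))

diffs : ∀ {d} → Vec ℕ d → Vec ℕ d → List ℕ
diffs v w = zipWith ∣_-_∣ (toList v) (toList w)

-- gcd(v_1 - w_1, ..., v_d - w_d)  (gcd of the absolute values; gcd of the empty list is 0)
gcdList : List ℕ → ℕ
gcdList = foldr gcd 0

Visible : ∀ {d} → Vec ℕ d × Vec ℕ d → Set
Visible (v , w) = gcdList (diffs v w) ≡ 1

visible? : ∀ {d} (p : Vec ℕ d × Vec ℕ d) → Dec (Visible p)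
visible? (v , w) = gcdList (diffs v w) ℕ.≟ 1

Ω : (d N : ℕ) → List (Vec ℕ d × Vec ℕ d)
Ω d N = filter visible? (cartesianProduct (grid d N) (grid d N))

sqDist : ∀ {d} → Vec ℕ d → Vec ℕ d → ℕ
sqDist v w = sum (map (λ x → x ℕ.* x) (diffs v w))

-- a / b as a rational (b = 0 does not occur in the theorem; returns 0 then)
divℚ : ℕ → ℕ → ℚ
divℚ a zero    = 0ℚ
divℚ a (suc b) = + a / suc b

-- dist_d(v,w)^2 = Σ (w_n - v_n)^2 / (N^2 d)   (a rational number)
distSq : (d N : ℕ) → Vec ℕ d → Vec ℕ d → ℚ
distSq d N v w = divℚ (sqDist v w) (N ℕ.* N ℕ.* d)

-- InBand ε x  ⇔  √x ∈ [1/√6 - ε, 1/√6 + ε]   for x ≥ 0, ε ≥ 0.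
-- Derivation: |√x − 1/√6| ≤ ε ⇔ (√x − 1/√6)² ≤ ε² ⇔ x + 1/6 − ε² ≤ 2√(x/6)
--             ⇔ t < 0 or t² ≤ (2/3)·x,  where t = x + 1/6 − ε².
InBand : ℚ → ℚ → Set
InBand ε x = (t < 0ℚ) ⊎ (t * t ≤ (+ 2 / 3) * x)
  where t = x + (+ 1 / 6) - ε * ε

inBand? : (ε x : ℚ) → Dec (InBand ε x)
inBand? ε x = (t <? 0ℚ) ⊎-dec (t * t ≤? (+ 2 / 3) * x)
  where t = x + (+ 1 / 6) - ε * ε

goodPairs : (ε : ℚ) (d N : ℕ) → List (Vec ℕ d × Vec ℕ d)
goodPairs ε d N = filter (λ { (v , w) → inBand? ε (distSq d N v w) }) (Ω d N)

{-# OPTIONS --safe #-}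
-- Summed over all pairs of grid points, the squared distance S(v,w) = Σₙ (vₙ - wₙ)² is a sum of d
-- independent coordinate contributions, with mean d·N(N+2)/6 and variance O(d·N⁴). By Chebyshev, all
-- but O(K²/d) of the (N+1)²ᵈ pairs satisfy |6S/(N²d) - 1| ≤ 1/K once N ≥ 4K, and when Kε ≥ 1 such a
-- pair is at normalised distance within ε of 1/√6.
-- A pair that is not mutually visible has all coordinates congruent modulo some k ∈ [2, N]; as at most
-- ((N+1)(N+1+k)/k)ᵈ pairs are congruent modulo k, at least half of all pairs are visible when N ≥ 19
-- and d ≥ 6. So the exceptional pairs form a fraction at most 288K²/d ≤ 1/K ≤ ε of Ω once d ≥ 288K³.
module Submission where

import Algebra.Properties.CommutativeSemigroup as CommutativeSemigroupProperties
open import Data.Empty using (⊥-elim)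
open import Data.Integer as ℤ using (+0; +[1+_]; -[1+_])
import Data.Integer.Properties as ℤ
open import Data.List using (List; []; _∷_; _++_; map; concatMap; upTo; applyUpTo; cartesianProduct; filter; length)
open import Data.Nat
open import Data.Nat.Properties
import Data.Nat.Coprimality as Coprimality
open import Data.Nat.DivMod using (_%_; [m+kn]%n≡m%n; [m+n]%n≡m%n; m<n⇒m%n≡m)
open import Data.Nat.Divisibility using (_∣_; divides; ∣-trans; ∣⇒≤; _∣0; ∣-refl)
open import Data.Nat.GCD using (gcd; gcd[m,n]∣m; gcd[m,n]∣n; gcd[0,0]≡0)
open import Data.Nat.Induction using (<-rec)
open import Data.Nat.Tactic.RingSolver using (solve-∀)
open import Data.Product using (Σ; _×_; _,_; proj₁; proj₂)
open import Data.Rational as ℚ using (ℚ; mkℚ; 0ℚ; 1ℚ; _-_; *≤*; *<*) renaming (_<_ to _<ℚ_; _≤_ to _≤ℚ_; _*_ to _*ℚ_; _+_ to _+ℚ_)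
import Data.Rational.Properties as ℚ
open import Data.Rational.Solver using (module +-*-Solver)
open +-*-Solver using (solve; con; _:+_; _:-_; _:*_; _:=_)
import Data.Rational.Unnormalised as ℚᵘ
import Data.Rational.Unnormalised.Properties as ℚᵘ
open import Data.Sum using (inj₁; inj₂)
open import Data.Vec using (Vec; []; _∷_)
open import Data.Vec.Relation.Unary.All using (All; []; _∷_)
open import Function using (_∘_; id)
open import Level using (Level)
open import Relation.Binary.PropositionalEquality
open import Relation.Nullary using (Dec; yes; no; ¬_)
open import Relation.Nullary.Decidable using (toWitness)
open import Relation.Unary using (Pred; Decidable)

open import Defs

private module +-CS = CommutativeSemigroupProperties +-commutativeSemigroup

-- Finite sums

private
  variable
    a b p : Level
    A B : Set a

sumOver : List A → (A → ℕ) → ℕ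
sumOver []       f = 0
sumOver (x ∷ xs) f = f x + sumOver xs f

syntax sumOver xs (λ x → e) = ∑[ x ∈ xs ] e

sumBelow : ℕ → (ℕ → ℕ) → ℕ
sumBelow zero    f = 0
sumBelow (suc n) f = sumBelow n f + f n

syntax sumBelow n (λ i → e) = ∑[ i < n ] e

𝟙 : {P : Set p} → Dec P → ℕ
𝟙 (yes _) = 1
𝟙 (no _)  = 0

𝟙ᶜ : {P : Set p} → Dec P → ℕ
𝟙ᶜ (yes _) = 0
𝟙ᶜ (no _)  = 1

𝟙+𝟙ᶜ≡1 : {P : Set p} (P? : Dec P) → 𝟙 P? + 𝟙ᶜ P? ≡ 1
𝟙+𝟙ᶜ≡1 (yes _) = refl
𝟙+𝟙ᶜ≡1 (no _)  = refl

𝟙≤1 : {P : Set p} (P? : Dec P) → 𝟙 P? ≤ 1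
𝟙≤1 (yes _) = ≤-refl
𝟙≤1 (no _)  = z≤n

𝟙ᶜ≤1 : {P : Set p} (P? : Dec P) → 𝟙ᶜ P? ≤ 1
𝟙ᶜ≤1 (yes _) = z≤n
𝟙ᶜ≤1 (no _)  = ≤-refl

𝟙-yes : {P : Set p} (P? : Dec P) → P → 𝟙 P? ≡ 1
𝟙-yes (yes _) _  = refl
𝟙-yes (no ¬P) P  = ⊥-elim (¬P P)

𝟙-no : {P : Set p} (P? : Dec P) → ¬ P → 𝟙 P? ≡ 0
𝟙-no (yes P) ¬P = ⊥-elim (¬P P)
𝟙-no (no _)  _  = refl

𝟙*≤ : {P : Set p} (P? : Dec P) {m n : ℕ} → (P → m ≤ n) → 𝟙 P? * m ≤ n
𝟙*≤ (yes P) m≤n = ≤-trans (≤-reflexive (+-identityʳ _)) (m≤n P)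
𝟙*≤ (no _)  _   = z≤n

sumOver-++ : ∀ (xs ys : List A) (f : A → ℕ) → sumOver (xs ++ ys) f ≡ sumOver xs f + sumOver ys f
sumOver-++ []       ys f = refl
sumOver-++ (x ∷ xs) ys f = trans (cong (f x +_) (sumOver-++ xs ys f)) (sym (+-assoc (f x) _ _))

sumOver-cong : ∀ (xs : List A) {f g : A → ℕ} → (∀ x → f x ≡ g x) → sumOver xs f ≡ sumOver xs g
sumOver-cong []       f≗g = refl
sumOver-cong (x ∷ xs) f≗g = cong₂ _+_ (f≗g x) (sumOver-cong xs f≗g)

sumOver-+ : ∀ (xs : List A) (f g : A → ℕ) → ∑[ x ∈ xs ] (f x + g x) ≡ sumOver xs f + sumOver xs g
sumOver-+ []       f g = refl
sumOver-+ (x ∷ xs) f g = trans (cong (f x + g x +_) (sumOver-+ xs f g)) (+-CS.interchange (f x) (g x) _ _)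

sumOver-*ˡ : ∀ (xs : List A) c (f : A → ℕ) → ∑[ x ∈ xs ] (c * f x) ≡ c * sumOver xs f
sumOver-*ˡ []       c f = sym (*-zeroʳ c)
sumOver-*ˡ (x ∷ xs) c f = trans (cong (c * f x +_) (sumOver-*ˡ xs c f)) (sym (*-distribˡ-+ c (f x) _))

sumOver-const : ∀ (xs : List A) c → ∑[ x ∈ xs ] c ≡ length xs * c
sumOver-const []       c = refl
sumOver-const (x ∷ xs) c = cong (c +_) (sumOver-const xs c)

length≡sumOver-𝟙 : ∀ (xs : List A) → length xs ≡ ∑[ x ∈ xs ] 1
length≡sumOver-𝟙 xs = sym (trans (sumOver-const xs 1) (*-identityʳ (length xs)))

sumOver-filter : ∀ (xs : List A) {P : Pred A p} (P? : Decidable P) (f : A → ℕ) →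
                 sumOver (filter P? xs) f ≡ ∑[ x ∈ xs ] (𝟙 (P? x) * f x)
sumOver-filter []       P? f = refl
sumOver-filter (x ∷ xs) P? f with P? x
... | yes _ = cong₂ _+_ (sym (+-identityʳ (f x))) (sumOver-filter xs P? f)
... | no _  = sumOver-filter xs P? f

length-filter≡sumOver-𝟙 : ∀ (xs : List A) {P : Pred A p} (P? : Decidable P) → length (filter P? xs) ≡ ∑[ x ∈ xs ] 𝟙 (P? x)
length-filter≡sumOver-𝟙 xs P? = begin
  length (filter P? xs)         ≡⟨ length≡sumOver-𝟙 (filter P? xs) ⟩
  ∑[ x ∈ filter P? xs ] 1       ≡⟨ sumOver-filter xs P? (λ _ → 1) ⟩
  ∑[ x ∈ xs ] (𝟙 (P? x) * 1)    ≡⟨ sumOver-cong xs (λ x → *-identityʳ (𝟙 (P? x))) ⟩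
  ∑[ x ∈ xs ] 𝟙 (P? x)          ∎
  where open ≡-Reasoning

sumOver-map : ∀ (xs : List A) (h : A → B) (f : B → ℕ) → sumOver (map h xs) f ≡ sumOver xs (f ∘ h)
sumOver-map []       h f = refl
sumOver-map (x ∷ xs) h f = cong (f (h x) +_) (sumOver-map xs h f)

sumOver-concatMap : ∀ (xs : List A) (g : A → List B) (f : B → ℕ) →
                    sumOver (concatMap g xs) f ≡ ∑[ x ∈ xs ] sumOver (g x) f
sumOver-concatMap []       g f = refl
sumOver-concatMap (x ∷ xs) g f =
  trans (sumOver-++ (g x) (concatMap g xs) f) (cong (sumOver (g x) f +_) (sumOver-concatMap xs g f))

sumOver-cartesianProduct : ∀ (xs : List A) (ys : List B) (f : A × B → ℕ) →
                           sumOver (cartesianProduct xs ys) f ≡ ∑[ x ∈ xs ] ∑[ y ∈ ys ] f (x , y)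
sumOver-cartesianProduct []       ys f = refl
sumOver-cartesianProduct (x ∷ xs) ys f =
  trans (sumOver-++ (map (x ,_) ys) _ f)
        (cong₂ _+_ (sumOver-map ys (x ,_) f) (sumOver-cartesianProduct xs ys f))

sumOver-comm : ∀ (xs : List A) (ys : List B) (f : A → B → ℕ) → ∑[ x ∈ xs ] ∑[ y ∈ ys ] f x y ≡ ∑[ y ∈ ys ] ∑[ x ∈ xs ] f x y
sumOver-comm []       ys f = sym (trans (sumOver-const ys 0) (*-zeroʳ (length ys)))
sumOver-comm (x ∷ xs) ys f =
  trans (cong (sumOver ys (f x) +_) (sumOver-comm xs ys f)) (sym (sumOver-+ ys (f x) _))

sumBelow-cong : ∀ n {f g : ℕ → ℕ} → (∀ i → i < n → f i ≡ g i) → sumBelow n f ≡ sumBelow n g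
sumBelow-cong zero    f≗g = refl
sumBelow-cong (suc n) f≗g = cong₂ _+_ (sumBelow-cong n (λ i i<n → f≗g i (m<n⇒m<1+n i<n))) (f≗g n ≤-refl)

sumBelow-mono-≤ : ∀ n {f g : ℕ → ℕ} → (∀ i → i < n → f i ≤ g i) → sumBelow n f ≤ sumBelow n g
sumBelow-mono-≤ zero    f≤g = z≤n
sumBelow-mono-≤ (suc n) f≤g = +-mono-≤ (sumBelow-mono-≤ n (λ i i<n → f≤g i (m<n⇒m<1+n i<n))) (f≤g n ≤-refl)

sumBelow-+ : ∀ n (f g : ℕ → ℕ) → ∑[ i < n ] (f i + g i) ≡ sumBelow n f + sumBelow n g
sumBelow-+ zero    f g = refl
sumBelow-+ (suc n) f g = trans (cong (_+ (f n + g n)) (sumBelow-+ n f g)) (+-CS.interchange (sumBelow n f) (sumBelow n g) (f n) (g n))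

sumBelow-*ˡ : ∀ n c (f : ℕ → ℕ) → ∑[ i < n ] (c * f i) ≡ c * sumBelow n f
sumBelow-*ˡ zero    c f = sym (*-zeroʳ c)
sumBelow-*ˡ (suc n) c f = trans (cong (_+ c * f n) (sumBelow-*ˡ n c f)) (sym (*-distribˡ-+ c _ (f n)))

sumBelow-*ʳ : ∀ n c (f : ℕ → ℕ) → ∑[ i < n ] (f i * c) ≡ sumBelow n f * c
sumBelow-*ʳ n c f = trans (sumBelow-cong n (λ i _ → *-comm (f i) c)) (trans (sumBelow-*ˡ n c f) (*-comm c _))

sumBelow-const : ∀ n c → ∑[ i < n ] c ≡ n * c
sumBelow-const zero    c = refl
sumBelow-const (suc n) c = trans (cong (_+ c) (sumBelow-const n c)) (+-comm (n * c) c)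

sumBelow-zero : ∀ n {f : ℕ → ℕ} → (∀ i → i < n → f i ≡ 0) → sumBelow n f ≡ 0
sumBelow-zero n f≗0 = trans (sumBelow-cong n f≗0) (trans (sumBelow-const n 0) (*-zeroʳ n))

sumBelow-+-split : ∀ m n (f : ℕ → ℕ) → sumBelow (m + n) f ≡ sumBelow m f + ∑[ i < n ] f (m + i)
sumBelow-+-split m zero    f = trans (cong (λ k → sumBelow k f) (+-identityʳ m)) (sym (+-identityʳ _))
sumBelow-+-split m (suc n) f =
  trans (cong (λ k → sumBelow k f) (+-suc m n))
        (trans (cong (_+ f (m + n)) (sumBelow-+-split m n f)) (+-assoc (sumBelow m f) _ _))

term≤sumBelow : ∀ n (f : ℕ → ℕ) {i} → i < n → f i ≤ sumBelow n f
term≤sumBelow (suc n) f {i} i<1+n with m≤n⇒m<n∨m≡n (s≤s⁻¹ i<1+n)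
... | inj₁ i<n  = ≤-trans (term≤sumBelow n f i<n) (m≤m+n _ _)
... | inj₂ refl = m≤n+m _ _

sumOver-applyUpTo : ∀ n (g f : ℕ → ℕ) → sumOver (applyUpTo g n) f ≡ sumBelow n (f ∘ g)
sumOver-applyUpTo zero    g f = refl
sumOver-applyUpTo (suc n) g f = trans (cong (f (g 0) +_) (sumOver-applyUpTo n (g ∘ suc) f)) (shift n (f ∘ g))
  where
  shift : ∀ n (h : ℕ → ℕ) → h 0 + sumBelow n (h ∘ suc) ≡ sumBelow (suc n) h
  shift zero    h = +-identityʳ (h 0)
  shift (suc n) h = trans (sym (+-assoc (h 0) _ _)) (cong (_+ h (suc n)) (shift n h))

sumOver-upTo : ∀ n (f : ℕ → ℕ) → sumOver (upTo n) f ≡ sumBelow n f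
sumOver-upTo n = sumOver-applyUpTo n id

sumBelow² : ℕ → (ℕ → ℕ → ℕ) → ℕ
sumBelow² M h = ∑[ a < M ] ∑[ b < M ] h a b

sumBelow²-cong : ∀ M {f g : ℕ → ℕ → ℕ} → (∀ a b → f a b ≡ g a b) → sumBelow² M f ≡ sumBelow² M g
sumBelow²-cong M f≗g = sumBelow-cong M (λ a _ → sumBelow-cong M (λ b _ → f≗g a b))

sumBelow²-mono-≤ : ∀ M {f g : ℕ → ℕ → ℕ} → (∀ a b → a < M → b < M → f a b ≤ g a b) → sumBelow² M f ≤ sumBelow² M g
sumBelow²-mono-≤ M f≤g = sumBelow-mono-≤ M (λ a a<M → sumBelow-mono-≤ M (λ b b<M → f≤g a b a<M b<M))

sumBelow²-+ : ∀ M (f g : ℕ → ℕ → ℕ) → sumBelow² M (λ a b → f a b + g a b) ≡ sumBelow² M f + sumBelow² M g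
sumBelow²-+ M f g = trans (sumBelow-cong M (λ a _ → sumBelow-+ M (f a) (g a))) (sumBelow-+ M _ _)

sumBelow²-*ˡ : ∀ M c (f : ℕ → ℕ → ℕ) → sumBelow² M (λ a b → c * f a b) ≡ c * sumBelow² M f
sumBelow²-*ˡ M c f = trans (sumBelow-cong M (λ a _ → sumBelow-*ˡ M c (f a))) (sumBelow-*ˡ M c _)

sumBelow²-*ʳ : ∀ M c (f : ℕ → ℕ → ℕ) → sumBelow² M (λ a b → f a b * c) ≡ sumBelow² M f * c
sumBelow²-*ʳ M c f = trans (sumBelow-cong M (λ a _ → sumBelow-*ʳ M c (f a))) (sumBelow-*ʳ M c _)

sumBelow²-const : ∀ M c → sumBelow² M (λ _ _ → c) ≡ M * M * c
sumBelow²-const M c = trans (sumBelow-cong M (λ a _ → sumBelow-const M c)) (trans (sumBelow-const M _) (sym (*-assoc M M c)))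

-- Sums over pairs of grid points

sumOver-grid-suc : ∀ d N (F : Vec ℕ (suc d) → ℕ) →
                   sumOver (grid (suc d) N) F ≡ ∑[ a < suc N ] ∑[ v ∈ grid d N ] F (a ∷ v)
sumOver-grid-suc d N F =
  trans (sumOver-concatMap (upTo (suc N)) (λ a → map (a ∷_) (grid d N)) F)
        (trans (sumOver-cong (upTo (suc N)) (λ a → sumOver-map (grid d N) (a ∷_) F)) (sumOver-upTo (suc N) _))

length-grid : ∀ d N → length (grid d N) ≡ suc N ^ d
length-grid zero    N = refl
length-grid (suc d) N = begin
  length (grid (suc d) N)                ≡⟨ length≡sumOver-𝟙 (grid (suc d) N) ⟩
  ∑[ v ∈ grid (suc d) N ] 1              ≡⟨ sumOver-grid-suc d N (λ _ → 1) ⟩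
  ∑[ a < suc N ] ∑[ v ∈ grid d N ] 1     ≡⟨ sumBelow-cong (suc N) (λ _ _ → sym (length≡sumOver-𝟙 (grid d N))) ⟩
  ∑[ a < suc N ] length (grid d N)       ≡⟨ sumBelow-const (suc N) _ ⟩
  suc N * length (grid d N)              ≡⟨ cong (suc N *_) (length-grid d N) ⟩
  suc N * suc N ^ d                      ∎
  where open ≡-Reasoning

sumPairs : (d N : ℕ) → (Vec ℕ d → Vec ℕ d → ℕ) → ℕ
sumPairs d N f = ∑[ v ∈ grid d N ] ∑[ w ∈ grid d N ] f v w

pairCount : ℕ → ℕ → ℕ
pairCount d N = suc N ^ d * suc N ^ d

sumPairs-suc : ∀ d N f →
               sumPairs (suc d) N f ≡ sumBelow² (suc N) (λ a b → sumPairs d N (λ v w → f (a ∷ v) (b ∷ w)))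
sumPairs-suc d N f = begin
  sumPairs (suc d) N f
    ≡⟨ sumOver-grid-suc d N _ ⟩
  ∑[ a < suc N ] ∑[ v ∈ grid d N ] ∑[ w ∈ grid (suc d) N ] f (a ∷ v) w
    ≡⟨ sumBelow-cong (suc N) (λ a _ → sumOver-cong (grid d N) (λ v → sumOver-grid-suc d N _)) ⟩
  ∑[ a < suc N ] ∑[ v ∈ grid d N ] ∑[ b < suc N ] ∑[ w ∈ grid d N ] f (a ∷ v) (b ∷ w)
    ≡⟨ sumBelow-cong (suc N) (λ a _ → sumOver-cong (grid d N) (λ v → sym (sumOver-upTo (suc N) _))) ⟩
  ∑[ a < suc N ] ∑[ v ∈ grid d N ] ∑[ b ∈ upTo (suc N) ] ∑[ w ∈ grid d N ] f (a ∷ v) (b ∷ w)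
    ≡⟨ sumBelow-cong (suc N) (λ a _ → sumOver-comm (grid d N) (upTo (suc N)) _) ⟩
  ∑[ a < suc N ] ∑[ b ∈ upTo (suc N) ] sumPairs d N (λ v w → f (a ∷ v) (b ∷ w))
    ≡⟨ sumBelow-cong (suc N) (λ a _ → sumOver-upTo (suc N) _) ⟩
  sumBelow² (suc N) (λ a b → sumPairs d N (λ v w → f (a ∷ v) (b ∷ w))) ∎
  where open ≡-Reasoning

sumPairs-cong : ∀ d N {f g} → (∀ v w → f v w ≡ g v w) → sumPairs d N f ≡ sumPairs d N g
sumPairs-cong d N f≗g = sumOver-cong (grid d N) (λ v → sumOver-cong (grid d N) (f≗g v))

sumPairs-+ : ∀ d N f g → sumPairs d N (λ v w → f v w + g v w) ≡ sumPairs d N f + sumPairs d N g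
sumPairs-+ d N f g = trans (sumOver-cong (grid d N) (λ v → sumOver-+ (grid d N) _ _)) (sumOver-+ (grid d N) _ _)

sumPairs-*ˡ : ∀ d N c f → sumPairs d N (λ v w → c * f v w) ≡ c * sumPairs d N f
sumPairs-*ˡ d N c f = trans (sumOver-cong (grid d N) (λ v → sumOver-*ˡ (grid d N) c _)) (sumOver-*ˡ (grid d N) c _)

sumPairs-const : ∀ d N c → sumPairs d N (λ _ _ → c) ≡ pairCount d N * c
sumPairs-const d N c = begin
  sumPairs d N (λ _ _ → c)                      ≡⟨ sumOver-cong (grid d N) (λ v → sumOver-const (grid d N) c) ⟩
  ∑[ v ∈ grid d N ] (length (grid d N) * c)     ≡⟨ sumOver-const (grid d N) _ ⟩
  length (grid d N) * (length (grid d N) * c)   ≡⟨ cong (λ l → l * (l * c)) (length-grid d N) ⟩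
  suc N ^ d * (suc N ^ d * c)                   ≡⟨ *-assoc (suc N ^ d) _ c ⟨
  pairCount d N * c                             ∎
  where open ≡-Reasoning

sumPairs-sumBelow : ∀ d N n (f : ℕ → Vec ℕ d → Vec ℕ d → ℕ) →
                    sumPairs d N (λ v w → ∑[ j < n ] f j v w) ≡ ∑[ j < n ] sumPairs d N (f j)
sumPairs-sumBelow d N zero    f = trans (sumPairs-const d N 0) (*-zeroʳ (pairCount d N))
sumPairs-sumBelow d N (suc n) f = trans (sumPairs-+ d N _ _) (cong (_+ sumPairs d N (f n)) (sumPairs-sumBelow d N n f))

sumPairs-mono-≤ : ∀ d N {f g} → (∀ v w → All (_≤ N) v → All (_≤ N) w → f v w ≤ g v w) →
                  sumPairs d N f ≤ sumPairs d N g
sumPairs-mono-≤ zero    N f≤g = +-monoˡ-≤ 0 (+-monoˡ-≤ 0 (f≤g [] [] [] []))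
sumPairs-mono-≤ (suc d) N {f} {g} f≤g = subst₂ _≤_ (sym (sumPairs-suc d N f)) (sym (sumPairs-suc d N g))
  (sumBelow²-mono-≤ (suc N) (λ a b a≤N b≤N →
    sumPairs-mono-≤ d N (λ v w v≤N w≤N → f≤g (a ∷ v) (b ∷ w) (s≤s⁻¹ a≤N ∷ v≤N) (s≤s⁻¹ b≤N ∷ w≤N))))

coordinatewiseProduct : ∀ {d} → (ℕ → ℕ → ℕ) → Vec ℕ d → Vec ℕ d → ℕ
coordinatewiseProduct h []       []       = 1
coordinatewiseProduct h (a ∷ v) (b ∷ w) = h a b * coordinatewiseProduct h v w

sumPairs-coordinatewiseProduct : ∀ d N h → sumPairs d N (coordinatewiseProduct h) ≡ sumBelow² (suc N) h ^ d
sumPairs-coordinatewiseProduct zero    N h = refl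
sumPairs-coordinatewiseProduct (suc d) N h = begin
  sumPairs (suc d) N (coordinatewiseProduct h)
    ≡⟨ sumPairs-suc d N _ ⟩
  sumBelow² (suc N) (λ a b → sumPairs d N (λ v w → h a b * coordinatewiseProduct h v w))
    ≡⟨ sumBelow²-cong (suc N) (λ a b → trans (sumPairs-*ˡ d N (h a b) _) (cong (h a b *_) (sumPairs-coordinatewiseProduct d N h))) ⟩
  sumBelow² (suc N) (λ a b → h a b * sumBelow² (suc N) h ^ d)
    ≡⟨ sumBelow²-*ʳ (suc N) _ h ⟩
  sumBelow² (suc N) h * sumBelow² (suc N) h ^ d ∎
  where open ≡-Reasoning

-- Moments of the squared distance

∣m-n∣²+2mn≡m²+n² : ∀ m n → ∣ m - n ∣ * ∣ m - n ∣ + 2 * m * n ≡ m * m + n * n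
∣m-n∣²+2mn≡m²+n² m n with ≤-total m n
... | inj₁ m≤n with m≤n⇒∃[o]m+o≡n m≤n
...   | k , refl rewrite ∣m-m+n∣≡n m k = identity m k
  where
  identity : ∀ m k → k * k + 2 * m * (m + k) ≡ m * m + (m + k) * (m + k)
  identity = solve-∀
∣m-n∣²+2mn≡m²+n² m n | inj₂ n≤m with m≤n⇒∃[o]m+o≡n n≤m
...   | k , refl rewrite ∣-∣-comm (n + k) n | ∣m-m+n∣≡n n k = identity n k
  where
  identity : ∀ n k → k * k + 2 * (n + k) * n ≡ (n + k) * (n + k) + n * n
  identity = solve-∀

sqDiff : ℕ → ℕ → ℕ
sqDiff a b = ∣ a - b ∣ * ∣ a - b ∣

module Moments (N : ℕ) where

  M M² : ℕ
  M  = suc N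
  M² = M * M

  σ₂ σ₄ : ℕ
  σ₂ = sumBelow² M sqDiff
  σ₄ = sumBelow² M (λ a b → sqDiff a b * sqDiff a b)

  firstMoment secondMoment : ℕ → ℕ
  firstMoment  d = sumPairs d N sqDist
  secondMoment d = sumPairs d N (λ v w → sqDist v w * sqDist v w)

  pairCount-suc : ∀ d → pairCount (suc d) N ≡ M² * pairCount d N
  pairCount-suc d = shuffle M (M ^ d)
    where
    shuffle : ∀ x y → x * y * (x * y) ≡ x * x * (y * y)
    shuffle = solve-∀

  firstMoment-suc : ∀ d → firstMoment (suc d) ≡ σ₂ * pairCount d N + M² * firstMoment d
  firstMoment-suc d = begin
    firstMoment (suc d)
      ≡⟨ sumPairs-suc d N sqDist ⟩
    sumBelow² M (λ a b → sumPairs d N (λ v w → sqDiff a b + sqDist v w))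
      ≡⟨ sumBelow²-cong M (λ a b → trans (sumPairs-+ d N _ _) (cong (_+ firstMoment d) (sumPairs-const d N (sqDiff a b)))) ⟩
    sumBelow² M (λ a b → pairCount d N * sqDiff a b + firstMoment d)
      ≡⟨ sumBelow²-+ M _ _ ⟩
    sumBelow² M (λ a b → pairCount d N * sqDiff a b) + sumBelow² M (λ _ _ → firstMoment d)
      ≡⟨ cong₂ _+_ (trans (sumBelow²-*ˡ M (pairCount d N) sqDiff) (*-comm (pairCount d N) σ₂)) (sumBelow²-const M _) ⟩
    σ₂ * pairCount d N + M² * firstMoment d ∎
    where open ≡-Reasoning

  M²*firstMoment : ∀ d → M² * firstMoment d ≡ d * pairCount d N * σ₂
  M²*firstMoment zero    = *-zeroʳ M²
  M²*firstMoment (suc d) = begin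
    M² * firstMoment (suc d)                   ≡⟨ cong (M² *_) (firstMoment-suc d) ⟩
    M² * (σ₂ * t + M² * firstMoment d)         ≡⟨ cong (λ z → M² * (σ₂ * t + z)) (M²*firstMoment d) ⟩
    M² * (σ₂ * t + d * t * σ₂)                 ≡⟨ identity M² σ₂ t d ⟩
    suc d * (M² * t) * σ₂                      ≡⟨ cong (λ z → suc d * z * σ₂) (pairCount-suc d) ⟨
    suc d * pairCount (suc d) N * σ₂           ∎
    where
    open ≡-Reasoning
    t = pairCount d N
    identity : ∀ m a t d → m * (a * t + d * t * a) ≡ (1 + d) * (m * t) * a
    identity = solve-∀

  secondMoment-suc : ∀ d → secondMoment (suc d) ≡ σ₄ * pairCount d N + 2 * σ₂ * firstMoment d + M² * secondMoment d
  secondMoment-suc d = begin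
    secondMoment (suc d)
      ≡⟨ sumPairs-suc d N _ ⟩
    sumBelow² M (λ a b → sumPairs d N (λ v w → (sqDiff a b + sqDist v w) * (sqDiff a b + sqDist v w)))
      ≡⟨ sumBelow²-cong M (λ a b → expand (sqDiff a b)) ⟩
    sumBelow² M (λ a b → pairCount d N * (sqDiff a b * sqDiff a b) + 2 * firstMoment d * sqDiff a b + secondMoment d)
      ≡⟨ trans (sumBelow²-+ M _ _) (cong₂ _+_ (sumBelow²-+ M _ _) (sumBelow²-const M _)) ⟩
    sumBelow² M (λ a b → pairCount d N * (sqDiff a b * sqDiff a b)) + sumBelow² M (λ a b → 2 * firstMoment d * sqDiff a b)
      + M² * secondMoment d
      ≡⟨ cong₂ (λ x y → x + y + M² * secondMoment d) (sumBelow²-*ˡ M (pairCount d N) _) (sumBelow²-*ˡ M (2 * firstMoment d) sqDiff) ⟩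
    pairCount d N * σ₄ + 2 * firstMoment d * σ₂ + M² * secondMoment d
      ≡⟨ reorder (pairCount d N) σ₄ (firstMoment d) σ₂ (M² * secondMoment d) ⟩
    σ₄ * pairCount d N + 2 * σ₂ * firstMoment d + M² * secondMoment d ∎
    where
    open ≡-Reasoning
    reorder : ∀ t b e a z → t * b + 2 * e * a + z ≡ b * t + 2 * a * e + z
    reorder = solve-∀
    square : ∀ x s → (x + s) * (x + s) ≡ x * x + 2 * s * x + s * s
    square = solve-∀
    expand : ∀ x → sumPairs d N (λ v w → (x + sqDist v w) * (x + sqDist v w))
                 ≡ pairCount d N * (x * x) + 2 * firstMoment d * x + secondMoment d
    expand x = begin
      sumPairs d N (λ v w → (x + sqDist v w) * (x + sqDist v w))
        ≡⟨ sumPairs-cong d N (λ v w → square x (sqDist v w)) ⟩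
      sumPairs d N (λ v w → x * x + 2 * sqDist v w * x + sqDist v w * sqDist v w)
        ≡⟨ trans (sumPairs-+ d N _ _) (cong (_+ secondMoment d) (sumPairs-+ d N _ _)) ⟩
      sumPairs d N (λ _ _ → x * x) + sumPairs d N (λ v w → 2 * sqDist v w * x) + secondMoment d
        ≡⟨ cong₂ (λ y z → y + z + secondMoment d) (sumPairs-const d N (x * x)) linear ⟩
      pairCount d N * (x * x) + 2 * firstMoment d * x + secondMoment d ∎
      where
      linear : sumPairs d N (λ v w → 2 * sqDist v w * x) ≡ 2 * firstMoment d * x
      linear = begin
        sumPairs d N (λ v w → 2 * sqDist v w * x)   ≡⟨ sumPairs-cong d N (λ v w → *-comm (2 * sqDist v w) x) ⟩
        sumPairs d N (λ v w → x * (2 * sqDist v w)) ≡⟨ sumPairs-*ˡ d N x _ ⟩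
        x * sumPairs d N (λ v w → 2 * sqDist v w)   ≡⟨ cong (x *_) (sumPairs-*ˡ d N 2 sqDist) ⟩
        x * (2 * firstMoment d)                     ≡⟨ *-comm x _ ⟩
        2 * firstMoment d * x                       ∎

  -- Divided by M⁴·pairCount d N this is E[S²] = d·E[X²] + d(d-1)·E[X]² for the coordinate contribution X,
  -- whose moments are σ₂/M² and σ₄/M²; the term d·E[X]² is moved left to avoid truncated subtraction.
  M⁴*secondMoment : ∀ d → M² * M² * secondMoment d + d * pairCount d N * (σ₂ * σ₂)
                        ≡ d * pairCount d N * M² * σ₄ + d * d * pairCount d N * (σ₂ * σ₂)
  M⁴*secondMoment zero    = trans (+-identityʳ _) (trans (*-zeroʳ (M² * M²)) (sym (+-identityʳ _)))
  M⁴*secondMoment (suc d) = +-cancelʳ-≡ (M² * (d * t * (σ₂ * σ₂))) _ _ (begin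
    M² * M² * secondMoment (suc d) + suc d * pairCount (suc d) N * (σ₂ * σ₂) + M² * (d * t * (σ₂ * σ₂))
      ≡⟨ cong₂ (λ x y → M² * M² * x + suc d * y * (σ₂ * σ₂) + M² * (d * t * (σ₂ * σ₂))) (secondMoment-suc d) (pairCount-suc d) ⟩
    M² * M² * (σ₄ * t + 2 * σ₂ * e₁ + M² * e₂) + suc d * (M² * t) * (σ₂ * σ₂) + M² * (d * t * (σ₂ * σ₂))
      ≡⟨ regroup M² σ₄ t σ₂ e₁ e₂ d ⟩
    M² * M² * σ₄ * t + 2 * σ₂ * M² * (M² * e₁) + M² * (M² * M² * e₂ + d * t * (σ₂ * σ₂)) + suc d * (M² * t) * (σ₂ * σ₂)
      ≡⟨ cong₂ (λ x y → M² * M² * σ₄ * t + 2 * σ₂ * M² * x + M² * y + suc d * (M² * t) * (σ₂ * σ₂))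
               (M²*firstMoment d) (M⁴*secondMoment d) ⟩
    M² * M² * σ₄ * t + 2 * σ₂ * M² * (d * t * σ₂) + M² * (d * t * M² * σ₄ + d * d * t * (σ₂ * σ₂)) + suc d * (M² * t) * (σ₂ * σ₂)
      ≡⟨ collect M² σ₄ t σ₂ d ⟩
    suc d * (M² * t) * M² * σ₄ + suc d * suc d * (M² * t) * (σ₂ * σ₂) + M² * (d * t * (σ₂ * σ₂))
      ≡⟨ cong (λ y → suc d * y * M² * σ₄ + suc d * suc d * y * (σ₂ * σ₂) + M² * (d * t * (σ₂ * σ₂))) (pairCount-suc d) ⟨
    suc d * pairCount (suc d) N * M² * σ₄ + suc d * suc d * pairCount (suc d) N * (σ₂ * σ₂) + M² * (d * t * (σ₂ * σ₂)) ∎)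
    where
    open ≡-Reasoning
    t  = pairCount d N
    e₁ = firstMoment d
    e₂ = secondMoment d
    regroup : ∀ m b t a e₁ e₂ d → m * m * (b * t + 2 * a * e₁ + m * e₂) + (1 + d) * (m * t) * (a * a) + m * (d * t * (a * a))
            ≡ m * m * b * t + 2 * a * m * (m * e₁) + m * (m * m * e₂ + d * t * (a * a)) + (1 + d) * (m * t) * (a * a)
    regroup = solve-∀
    collect : ∀ m b t a d → m * m * b * t + 2 * a * m * (d * t * a) + m * (d * t * m * b + d * d * t * (a * a)) + (1 + d) * (m * t) * (a * a)
            ≡ (1 + d) * (m * t) * m * b + (1 + d) * (1 + d) * (m * t) * (a * a) + m * (d * t * (a * a))
    collect = solve-∀

-- Concentration

gauss-sum : ∀ n → 2 * ∑[ i < suc n ] i ≡ n * suc n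
gauss-sum zero    = refl
gauss-sum (suc n) = begin
  2 * (∑[ i < suc n ] i + suc n)      ≡⟨ *-distribˡ-+ 2 (∑[ i < suc n ] i) (suc n) ⟩
  2 * ∑[ i < suc n ] i + 2 * suc n    ≡⟨ cong (_+ 2 * suc n) (gauss-sum n) ⟩
  n * suc n + 2 * suc n               ≡⟨ identity n ⟩
  suc n * suc (suc n)                 ∎
  where
  open ≡-Reasoning
  identity : ∀ n → n * (1 + n) + 2 * (1 + n) ≡ (1 + n) * (2 + n)
  identity = solve-∀

sum-of-squares : ∀ n → 6 * ∑[ i < suc n ] (i * i) ≡ n * suc n * (2 * n + 1)
sum-of-squares zero    = refl
sum-of-squares (suc n) = begin
  6 * (∑[ i < suc n ] (i * i) + suc n * suc n)     ≡⟨ *-distribˡ-+ 6 (∑[ i < suc n ] (i * i)) _ ⟩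
  6 * ∑[ i < suc n ] (i * i) + 6 * (suc n * suc n) ≡⟨ cong (_+ 6 * (suc n * suc n)) (sum-of-squares n) ⟩
  n * suc n * (2 * n + 1) + 6 * (suc n * suc n)    ≡⟨ identity n ⟩
  suc n * suc (suc n) * (2 * suc n + 1)            ∎
  where
  open ≡-Reasoning
  identity : ∀ n → n * (1 + n) * (2 * n + 1) + 6 * ((1 + n) * (1 + n)) ≡ (1 + n) * (2 + n) * (2 * (1 + n) + 1)
  identity = solve-∀

chebyshev-sumPairs : ∀ d N t (f : Vec ℕ d → Vec ℕ d → ℕ) →
                     sumPairs d N (λ v w → 𝟙 (t <? f v w)) * (t * t) ≤ sumPairs d N (λ v w → f v w * f v w)
chebyshev-sumPairs d N t f = begin
  sumPairs d N (λ v w → 𝟙 (t <? f v w)) * (t * t)  ≡⟨ *-comm _ (t * t) ⟩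
  (t * t) * sumPairs d N (λ v w → 𝟙 (t <? f v w))  ≡⟨ sumPairs-*ˡ d N (t * t) _ ⟨
  sumPairs d N (λ v w → t * t * 𝟙 (t <? f v w))    ≤⟨ sumPairs-mono-≤ d N (λ v w _ _ → pointwise (f v w)) ⟩
  sumPairs d N (λ v w → f v w * f v w)             ∎
  where
  open ≤-Reasoning
  pointwise : ∀ x → t * t * 𝟙 (t <? x) ≤ x * x
  pointwise x = subst (_≤ x * x) (*-comm (𝟙 (t <? x)) (t * t)) (𝟙*≤ (t <? x) (λ t<x → *-mono-≤ (<⇒≤ t<x) (<⇒≤ t<x)))

module Concentration (N : ℕ) where
  open Moments N public

  6*σ₂ : 6 * σ₂ ≡ M² * (N * (N + 2))
  6*σ₂ = +-cancelʳ-≡ (3 * ((N * M) * (N * M))) _ _ (begin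
    6 * σ₂ + 3 * ((N * M) * (N * M))       ≡⟨ cong (λ z → 6 * σ₂ + 3 * (z * z)) (gauss-sum N) ⟨
    6 * σ₂ + 3 * ((2 * s₁) * (2 * s₁))     ≡⟨ factor σ₂ s₁ ⟩
    6 * (σ₂ + 2 * (s₁ * s₁))               ≡⟨ cong (6 *_) σ₂+2s₁² ⟩
    6 * (M * s₂ + M * s₂)                  ≡⟨ regroup M s₂ ⟩
    2 * M * (6 * s₂)                       ≡⟨ cong (2 * M *_) (sum-of-squares N) ⟩
    2 * M * (N * M * (2 * N + 1))          ≡⟨ expand N ⟩
    M² * (N * (N + 2)) + 3 * ((N * M) * (N * M)) ∎)
    where
    open ≡-Reasoning
    s₁ = ∑[ a < M ] a
    s₂ = ∑[ a < M ] (a * a)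
    factor : ∀ a s → 6 * a + 3 * ((2 * s) * (2 * s)) ≡ 6 * (a + 2 * (s * s))
    factor = solve-∀
    regroup : ∀ m s → 6 * (m * s + m * s) ≡ 2 * m * (6 * s)
    regroup = solve-∀
    expand : ∀ n → 2 * (1 + n) * (n * (1 + n) * (2 * n + 1)) ≡ (1 + n) * (1 + n) * (n * (n + 2)) + 3 * ((n * (1 + n)) * (n * (1 + n)))
    expand = solve-∀
    ∑ab : sumBelow² M (λ a b → a * b) ≡ s₁ * s₁
    ∑ab = trans (sumBelow-cong M (λ a _ → sumBelow-*ˡ M a (λ b → b))) (sumBelow-*ʳ M s₁ (λ a → a))
    σ₂+2s₁² : σ₂ + 2 * (s₁ * s₁) ≡ M * s₂ + M * s₂
    σ₂+2s₁² = begin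
      σ₂ + 2 * (s₁ * s₁)                                ≡⟨ cong (λ z → σ₂ + 2 * z) ∑ab ⟨
      σ₂ + 2 * sumBelow² M (λ a b → a * b)              ≡⟨ cong (σ₂ +_) (sumBelow²-*ˡ M 2 (λ a b → a * b)) ⟨
      σ₂ + sumBelow² M (λ a b → 2 * (a * b))            ≡⟨ sumBelow²-+ M sqDiff _ ⟨
      sumBelow² M (λ a b → sqDiff a b + 2 * (a * b))
        ≡⟨ sumBelow²-cong M (λ a b → trans (cong (sqDiff a b +_) (sym (*-assoc 2 a b))) (∣m-n∣²+2mn≡m²+n² a b)) ⟩
      sumBelow² M (λ a b → a * a + b * b)               ≡⟨ sumBelow²-+ M _ _ ⟩
      sumBelow² M (λ a b → a * a) + sumBelow² M (λ a b → b * b)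
        ≡⟨ cong₂ _+_ (trans (sumBelow-cong M (λ a _ → sumBelow-const M (a * a))) (sumBelow-*ˡ M M (λ a → a * a)))
                     (sumBelow-const M s₂) ⟩
      M * s₂ + M * s₂                                   ∎

  σ₄≤ : σ₄ ≤ M² * (N * N * (N * N))
  σ₄≤ = ≤-trans (sumBelow²-mono-≤ M (λ a b a<M b<M → pointwise (s≤s⁻¹ a<M) (s≤s⁻¹ b<M))) (≤-reflexive (sumBelow²-const M _))
    where
    pointwise : ∀ {a b} → a ≤ N → b ≤ N → sqDiff a b * sqDiff a b ≤ N * N * (N * N)
    pointwise {a} {b} a≤N b≤N = let δ≤N = ≤-trans (∣m-n∣≤m⊔n a b) (⊔-lub a≤N b≤N)
                                    δ²≤N² = *-mono-≤ δ≤N δ≤N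
                                in *-mono-≤ δ²≤N² δ²≤N²

  deviation : ∀ {d} → Vec ℕ d → Vec ℕ d → ℕ
  deviation {d} v w = ∣ M² * sqDist v w - d * σ₂ ∣

  variance : ℕ → ℕ
  variance d = sumPairs d N (λ v w → deviation v w * deviation v w)

  variance-identity : ∀ d → variance d + 2 * (d * σ₂) * (M² * firstMoment d)
                            ≡ M² * M² * secondMoment d + pairCount d N * ((d * σ₂) * (d * σ₂))
  variance-identity d = begin
    variance d + 2 * (d * σ₂) * (M² * firstMoment d)
      ≡⟨ cong (variance d +_) (trans (sumPairs-*ˡ d N (2 * (d * σ₂)) _) (cong (2 * (d * σ₂) *_) (sumPairs-*ˡ d N M² sqDist))) ⟨
    variance d + sumPairs d N (λ v w → 2 * (d * σ₂) * (M² * sqDist v w))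
      ≡⟨ sumPairs-+ d N _ _ ⟨
    sumPairs d N (λ v w → sqDiff (M² * sqDist v w) (d * σ₂) + 2 * (d * σ₂) * (M² * sqDist v w))
      ≡⟨ sumPairs-cong d N (λ v w → trans (cong (sqDiff (M² * sqDist v w) (d * σ₂) +_) (swap (d * σ₂) (M² * sqDist v w)))
                                          (∣m-n∣²+2mn≡m²+n² (M² * sqDist v w) (d * σ₂))) ⟩
    sumPairs d N (λ v w → (M² * sqDist v w) * (M² * sqDist v w) + (d * σ₂) * (d * σ₂))
      ≡⟨ sumPairs-cong d N (λ v w → cong (_+ (d * σ₂) * (d * σ₂)) (square M² (sqDist v w))) ⟩
    sumPairs d N (λ v w → M² * M² * (sqDist v w * sqDist v w) + (d * σ₂) * (d * σ₂))
      ≡⟨ trans (sumPairs-+ d N _ _) (cong₂ _+_ (sumPairs-*ˡ d N (M² * M²) _) (sumPairs-const d N _)) ⟩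
    M² * M² * secondMoment d + pairCount d N * ((d * σ₂) * (d * σ₂)) ∎
    where
    open ≡-Reasoning
    swap : ∀ c x → 2 * c * x ≡ 2 * x * c
    swap = solve-∀
    square : ∀ m s → (m * s) * (m * s) ≡ m * m * (s * s)
    square = solve-∀

  variance≤ : ∀ d → variance d ≤ d * pairCount d N * M² * σ₄
  variance≤ d = ≤-trans (m≤m+n (variance d) (d * t * (σ₂ * σ₂)))
                        (≤-reflexive (+-cancelʳ-≡ (2 * (d * d * t * (σ₂ * σ₂))) _ _ (begin
    variance d + d * t * (σ₂ * σ₂) + 2 * (d * d * t * (σ₂ * σ₂))
      ≡⟨ regroup₁ (variance d) d t σ₂ ⟩
    variance d + 2 * (d * σ₂) * (d * t * σ₂) + d * t * (σ₂ * σ₂)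
      ≡⟨ cong (λ z → variance d + 2 * (d * σ₂) * z + d * t * (σ₂ * σ₂)) (M²*firstMoment d) ⟨
    variance d + 2 * (d * σ₂) * (M² * firstMoment d) + d * t * (σ₂ * σ₂)
      ≡⟨ cong (_+ d * t * (σ₂ * σ₂)) (variance-identity d) ⟩
    M² * M² * secondMoment d + t * ((d * σ₂) * (d * σ₂)) + d * t * (σ₂ * σ₂)
      ≡⟨ regroup₂ (M² * M² * secondMoment d) t d σ₂ ⟩
    M² * M² * secondMoment d + d * t * (σ₂ * σ₂) + d * d * t * (σ₂ * σ₂)
      ≡⟨ cong (_+ d * d * t * (σ₂ * σ₂)) (M⁴*secondMoment d) ⟩
    d * t * M² * σ₄ + d * d * t * (σ₂ * σ₂) + d * d * t * (σ₂ * σ₂)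
      ≡⟨ double (d * t * M² * σ₄) (d * d * t * (σ₂ * σ₂)) ⟩
    d * t * M² * σ₄ + 2 * (d * d * t * (σ₂ * σ₂)) ∎)))
    where
    open ≡-Reasoning
    t = pairCount d N
    regroup₁ : ∀ v d t a → v + d * t * (a * a) + 2 * (d * d * t * (a * a)) ≡ v + 2 * (d * a) * (d * t * a) + d * t * (a * a)
    regroup₁ = solve-∀
    regroup₂ : ∀ e t d a → e + t * ((d * a) * (d * a)) + d * t * (a * a) ≡ e + d * t * (a * a) + d * d * t * (a * a)
    regroup₂ = solve-∀
    double : ∀ x y → x + y + y ≡ x + 2 * y
    double = solve-∀

  FarFromMean : ℕ → ∀ {d} → Vec ℕ d → Vec ℕ d → Set
  FarFromMean K {d} v w = d * (N * N) * M² < 12 * K * deviation v w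

  farFromMean? : ∀ K {d} (v w : Vec ℕ d) → Dec (FarFromMean K v w)
  farFromMean? K {d} v w = d * (N * N) * M² <? 12 * K * deviation v w

  d*count-farFromMean≤ : ∀ K d → 1 ≤ d → 1 ≤ N →
                         sumPairs d N (λ v w → 𝟙 (farFromMean? K v w)) * d ≤ 144 * (K * K) * pairCount d N
  d*count-farFromMean≤ K d@(suc _) _ 1≤N = *-cancelʳ-≤ _ _ (d * N⁴ * (M² * M²)) {{m*n≢0 (d * N⁴) (M² * M²)}} (begin
    far * d * (d * N⁴ * (M² * M²))                       ≡⟨ square-threshold far d N M² ⟩
    far * (L * L)                                        ≤⟨ chebyshev-sumPairs d N L (λ v w → 12 * K * deviation v w) ⟩
    sumPairs d N (λ v w → 12 * K * deviation v w * (12 * K * deviation v w))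
      ≡⟨ sumPairs-cong d N (λ v w → square (12 * K) (deviation v w)) ⟩
    sumPairs d N (λ v w → 12 * K * (12 * K) * (deviation v w * deviation v w))
      ≡⟨ sumPairs-*ˡ d N (12 * K * (12 * K)) _ ⟩
    12 * K * (12 * K) * variance d                       ≤⟨ *-monoʳ-≤ (12 * K * (12 * K)) (variance≤ d) ⟩
    12 * K * (12 * K) * (d * t * M² * σ₄)                ≤⟨ *-monoʳ-≤ (12 * K * (12 * K)) (*-monoʳ-≤ (d * t * M²) σ₄≤) ⟩
    12 * K * (12 * K) * (d * t * M² * (M² * N⁴))         ≡⟨ collect K d t M² N ⟩
    144 * (K * K) * t * (d * N⁴ * (M² * M²))             ∎)
    where
    open ≤-Reasoning
    far = sumPairs d N (λ v w → 𝟙 (farFromMean? K v w))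
    t   = pairCount d N
    L   = d * (N * N) * M²
    N⁴  = N * N * (N * N)
    instance
      N≢0 : NonZero N
      N≢0 = >-nonZero 1≤N
      N²≢0 : NonZero (N * N)
      N²≢0 = m*n≢0 N N
      N⁴≢0 : NonZero N⁴
      N⁴≢0 = m*n≢0 (N * N) (N * N)
      dN⁴≢0 : NonZero (d * N⁴)
      dN⁴≢0 = m*n≢0 d N⁴
    square-threshold : ∀ c d n m → c * d * (d * (n * n * (n * n)) * (m * m)) ≡ c * ((d * (n * n) * m) * (d * (n * n) * m))
    square-threshold = solve-∀
    square : ∀ k x → k * x * (k * x) ≡ k * k * (x * x)
    square = solve-∀
    collect : ∀ k d t m n → 12 * k * (12 * k) * (d * t * m * (m * (n * n * (n * n)))) ≡ 144 * (k * k) * t * (d * (n * n * (n * n)) * (m * m))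
    collect = solve-∀

  -- The mean of sqDist is d·σ₂/M² = d·N(N+2)/6, which differs from d·N²/6 by d·N/3; 4K ≤ N absorbs that bias.
  ¬farFromMean⇒K*∣6s-N²d∣≤N²d : ∀ K {d} (v w : Vec ℕ d) → 4 * K ≤ N → ¬ FarFromMean K v w →
                                 K * ∣ 6 * sqDist v w - N * N * d ∣ ≤ N * N * d
  ¬farFromMean⇒K*∣6s-N²d∣≤N²d K {d} v w 4K≤N near = *-cancelˡ-≤ 2 (begin
    2 * (K * ∣ 6 * s - N * N * d ∣)                           ≡⟨ *-assoc 2 K _ ⟨
    2 * K * ∣ 6 * s - N * N * d ∣                             ≤⟨ *-monoʳ-≤ (2 * K) (∣-∣-triangle (6 * s) μ (N * N * d)) ⟩
    2 * K * (∣ 6 * s - μ ∣ + ∣ μ - N * N * d ∣)               ≡⟨ cong (λ z → 2 * K * (∣ 6 * s - μ ∣ + z)) bias ⟩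
    2 * K * (∣ 6 * s - μ ∣ + 2 * d * N)                       ≡⟨ *-distribˡ-+ (2 * K) _ _ ⟩
    2 * K * ∣ 6 * s - μ ∣ + 2 * K * (2 * d * N)               ≤⟨ +-mono-≤ spread small-bias ⟩
    d * (N * N) + N * N * d                                   ≡⟨ double d N ⟩
    2 * (N * N * d)                                           ∎)
    where
    open ≤-Reasoning
    s = sqDist v w
    μ = d * (N * (N + 2))
    double : ∀ d n → d * (n * n) + n * n * d ≡ 2 * (n * n * d)
    double = solve-∀
    bias : ∣ μ - N * N * d ∣ ≡ 2 * d * N
    bias = trans (cong (λ z → ∣ z - N * N * d ∣) (expand N d))
                 (trans (∣-∣-comm (N * N * d + 2 * d * N) _) (∣m-m+n∣≡n (N * N * d) (2 * d * N)))
      where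
      expand : ∀ n d → d * (n * (n + 2)) ≡ n * n * d + 2 * d * n
      expand = solve-∀
    6*deviation : 6 * deviation v w ≡ M² * ∣ 6 * s - μ ∣
    6*deviation = begin-equality
      6 * ∣ M² * s - d * σ₂ ∣                    ≡⟨ *-distribˡ-∣-∣ 6 (M² * s) (d * σ₂) ⟩
      ∣ 6 * (M² * s) - 6 * (d * σ₂) ∣            ≡⟨ cong₂ ∣_-_∣ (swap 6 M² s) (trans (swap 6 d σ₂) (cong (d *_) 6*σ₂)) ⟩
      ∣ M² * (6 * s) - d * (M² * (N * (N + 2))) ∣ ≡⟨ cong (λ z → ∣ M² * (6 * s) - z ∣) (swap d M² (N * (N + 2))) ⟩
      ∣ M² * (6 * s) - M² * μ ∣                  ≡⟨ *-distribˡ-∣-∣ M² (6 * s) μ ⟨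
      M² * ∣ 6 * s - μ ∣                         ∎
      where
      swap : ∀ a b c → a * (b * c) ≡ b * (a * c)
      swap = solve-∀
    spread : 2 * K * ∣ 6 * s - μ ∣ ≤ d * (N * N)
    spread = *-cancelˡ-≤ M² {{m*n≢0 M M}} (begin
      M² * (2 * K * ∣ 6 * s - μ ∣)    ≡⟨ swap (2 * K) M² _ ⟩
      2 * K * (M² * ∣ 6 * s - μ ∣)    ≡⟨ cong (2 * K *_) 6*deviation ⟨
      2 * K * (6 * deviation v w)     ≡⟨ twelve K _ ⟩
      12 * K * deviation v w          ≤⟨ ≮⇒≥ near ⟩
      d * (N * N) * M²                ≡⟨ *-comm (d * (N * N)) M² ⟩
      M² * (d * (N * N))              ∎)
      where
      swap : ∀ k m x → m * (k * x) ≡ k * (m * x)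
      swap = solve-∀
      twelve : ∀ k x → 2 * k * (6 * x) ≡ 12 * k * x
      twelve = solve-∀
    small-bias : 2 * K * (2 * d * N) ≤ N * N * d
    small-bias = begin
      2 * K * (2 * d * N)   ≡⟨ regroup K d N ⟩
      4 * K * (N * d)       ≤⟨ *-monoˡ-≤ (N * d) 4K≤N ⟩
      N * (N * d)           ≡⟨ *-assoc N N d ⟨
      N * N * d             ∎
      where
      regroup : ∀ k d n → 2 * k * (2 * d * n) ≡ 4 * k * (n * d)
      regroup = solve-∀

-- Visible pairs

congruent? : ∀ k .{{_ : NonZero k}} (a b : ℕ) → Dec (a % k ≡ b % k)
congruent? k a b = a % k ≟ b % k

allCongruent : ∀ k .{{_ : NonZero k}} {d} → Vec ℕ d → Vec ℕ d → ℕ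
allCongruent k = coordinatewiseProduct (λ a b → 𝟙 (congruent? k a b))

∣∣m-n∣⇒m%k≡n%k : ∀ {k} .{{_ : NonZero k}} m n → k ∣ ∣ m - n ∣ → m % k ≡ n % k
∣∣m-n∣⇒m%k≡n%k {k} m n k∣∣m-n∣ with ≤-total m n
... | inj₁ m≤n with m≤n⇒∃[o]m+o≡n m≤n
...   | o , refl with subst (k ∣_) (∣m-m+n∣≡n m o) k∣∣m-n∣
...     | divides q refl = sym ([m+kn]%n≡m%n m q k)
∣∣m-n∣⇒m%k≡n%k {k} m n k∣∣m-n∣ | inj₂ n≤m with m≤n⇒∃[o]m+o≡n n≤m
...   | o , refl with subst (k ∣_) (trans (∣-∣-comm (n + o) n) (∣m-m+n∣≡n n o)) k∣∣m-n∣
...     | divides q refl = [m+kn]%n≡m%n n q k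

∣gcd⇒allCongruent≡1 : ∀ {k} .{{_ : NonZero k}} {d} (v w : Vec ℕ d) → k ∣ gcdList (diffs v w) → allCongruent k v w ≡ 1
∣gcd⇒allCongruent≡1     []      []      _     = refl
∣gcd⇒allCongruent≡1 {k} (a ∷ v) (b ∷ w) k∣gcd = cong₂ _*_
  (𝟙-yes (congruent? k a b) (∣∣m-n∣⇒m%k≡n%k a b (∣-trans k∣gcd (gcd[m,n]∣m ∣ a - b ∣ (gcdList (diffs v w))))))
  (∣gcd⇒allCongruent≡1 v w (∣-trans k∣gcd (gcd[m,n]∣n ∣ a - b ∣ (gcdList (diffs v w)))))

gcd≤N : ∀ {N d} (v w : Vec ℕ d) → All (_≤ N) v → All (_≤ N) w → gcdList (diffs v w) ≢ 0 → gcdList (diffs v w) ≤ N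
gcd≤N []      []      _           _           g≢0 = ⊥-elim (g≢0 refl)
gcd≤N (a ∷ v) (b ∷ w) (a≤N ∷ v≤N) (b≤N ∷ w≤N) g≢0 with ∣ a - b ∣ ≟ 0
... | no  δ≢0 = ≤-trans (∣⇒≤ {{≢-nonZero δ≢0}} (gcd[m,n]∣m ∣ a - b ∣ _)) (≤-trans (∣m-n∣≤m⊔n a b) (⊔-lub a≤N b≤N))
... | yes δ≡0 = ≤-trans (∣⇒≤ {{≢-nonZero g′≢0}} (gcd[m,n]∣n ∣ a - b ∣ g′)) (gcd≤N v w v≤N w≤N g′≢0)
  where
  g′ = gcdList (diffs v w)
  g′≢0 : g′ ≢ 0
  g′≢0 g′≡0 = g≢0 (trans (cong₂ gcd δ≡0 g′≡0) gcd[0,0]≡0)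

-- If the gcd g of the coordinate differences is not 1, the points are congruent modulo g when g ≥ 2
-- (and then g ≤ N), and modulo 2 when g = 0, i.e. when v = w.
𝟙ᶜvisible≤ : ∀ {N d} (v w : Vec ℕ d) → All (_≤ N) v → All (_≤ N) w →
             𝟙ᶜ (visible? (v , w)) ≤ allCongruent 2 v w + allCongruent 3 v w + ∑[ j < N ∸ 3 ] allCongruent (4 + j) v w
𝟙ᶜvisible≤ {N} v w v≤N w≤N with visible? (v , w)
... | yes _   = z≤n
... | no  g≢1 = bound (gcdList (diffs v w)) refl g≢1
  where
  c₂ = allCongruent 2 v w
  c₃ = allCongruent 3 v w
  c₄₊ = ∑[ j < N ∸ 3 ] allCongruent (4 + j) v w
  congruent : ∀ {g k} .{{_ : NonZero k}} → g ≡ gcdList (diffs v w) → k ∣ g → 1 ≤ allCongruent k v w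
  congruent refl k∣g = ≤-reflexive (sym (∣gcd⇒allCongruent≡1 v w k∣g))
  via₂ : ∀ {g} → g ≡ gcdList (diffs v w) → 2 ∣ g → 1 ≤ c₂ + c₃ + c₄₊
  via₂ g≡ 2∣g = ≤-trans (congruent g≡ 2∣g) (≤-trans (m≤m+n c₂ c₃) (m≤m+n (c₂ + c₃) c₄₊))
  bound : ∀ g → g ≡ gcdList (diffs v w) → g ≢ 1 → 1 ≤ c₂ + c₃ + c₄₊
  bound 0 g≡ _   = via₂ g≡ (2 ∣0)
  bound 1 _  g≢1 = ⊥-elim (g≢1 refl)
  bound 2 g≡ _   = via₂ g≡ ∣-refl
  bound 3 g≡ _   = ≤-trans (congruent g≡ ∣-refl) (≤-trans (m≤n+m c₃ c₂) (m≤m+n (c₂ + c₃) c₄₊))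
  bound (suc (suc (suc (suc j)))) g≡ _ =
    ≤-trans (congruent g≡ ∣-refl)
            (≤-trans (term≤sumBelow (N ∸ 3) (λ j → allCongruent (4 + j) v w) j<N∸3) (m≤n+m c₄₊ (c₂ + c₃)))
    where
    j<N∸3 : j < N ∸ 3
    j<N∸3 = ∸-monoˡ-≤ 3 (subst (_≤ N) (sym g≡) (gcd≤N v w v≤N w≤N (λ g≡0 → 0≢1+n (trans (sym g≡0) (sym g≡)))))

∑[b<n]𝟙[r≡b]≤1 : ∀ n r → ∑[ b < n ] 𝟙 (r ≟ b) ≤ 1
∑[b<n]𝟙[r≡b]≤1 zero    r = z≤n
∑[b<n]𝟙[r≡b]≤1 (suc n) r with r ≟ n
... | yes refl = ≤-reflexive (cong (_+ 1) (sumBelow-zero n (λ b b<r → 𝟙-no (r ≟ b) (λ r≡b → <-irrefl (sym r≡b) b<r))))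
... | no  _    = ≤-trans (≤-reflexive (+-identityʳ _)) (∑[b<n]𝟙[r≡b]≤1 n r)

module _ (k : ℕ) .{{_ : NonZero k}} (a : ℕ) where

  congruentBelow : ℕ → ℕ
  congruentBelow n = ∑[ b < n ] 𝟙 (congruent? k a b)

  congruentBelow≤1 : ∀ n → n ≤ k → congruentBelow n ≤ 1
  congruentBelow≤1 n n≤k = ≤-trans
    (≤-reflexive (sumBelow-cong n (λ b b<n → cong (λ r → 𝟙 (a % k ≟ r)) (m<n⇒m%n≡m (<-≤-trans b<n n≤k)))))
    (∑[b<n]𝟙[r≡b]≤1 n (a % k))

  congruentBelow*k≤ : ∀ n → congruentBelow n * k ≤ n + k
  congruentBelow*k≤ = <-rec (λ n → congruentBelow n * k ≤ n + k) step
    where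
    step : ∀ n → (∀ {m} → m < n → congruentBelow m * k ≤ m + k) → congruentBelow n * k ≤ n + k
    step n rec with n ≤? k
    ... | yes n≤k = ≤-trans (*-monoˡ-≤ k (congruentBelow≤1 n n≤k)) (≤-trans (≤-reflexive (*-identityˡ k)) (m≤n+m k n))
    ... | no  n≰k with m≤n⇒∃[o]m+o≡n (<⇒≤ (≰⇒> n≰k))
    ...   | n′ , refl = begin
      congruentBelow (k + n′) * k                  ≡⟨ cong (_* k) (sumBelow-+-split k n′ _) ⟩
      (congruentBelow k + ∑[ i < n′ ] 𝟙 (congruent? k a (k + i))) * k
        ≡⟨ cong (λ z → (congruentBelow k + z) * k) (sumBelow-cong n′ (λ i _ → cong (λ r → 𝟙 (a % k ≟ r)) (periodic i))) ⟩
      (congruentBelow k + congruentBelow n′) * k  ≡⟨ *-distribʳ-+ k (congruentBelow k) _ ⟩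
      congruentBelow k * k + congruentBelow n′ * k
        ≤⟨ +-mono-≤ (≤-trans (*-monoˡ-≤ k (congruentBelow≤1 k ≤-refl)) (≤-reflexive (*-identityˡ k)))
                    (rec (m<n+m n′ (>-nonZero⁻¹ k))) ⟩
      k + (n′ + k)                                 ≡⟨ +-assoc k n′ k ⟨
      k + n′ + k                                   ∎
      where
      open ≤-Reasoning
      periodic : ∀ i → (k + i) % k ≡ i % k
      periodic i = trans (cong (_% k) (+-comm k i)) ([m+n]%n≡m%n i k)

congruentPairs : ℕ → ∀ k .{{_ : NonZero k}} → ℕ
congruentPairs N k = sumBelow² (suc N) (λ a b → 𝟙 (congruent? k a b))

congruentPairs*k≤ : ∀ N k .{{_ : NonZero k}} → congruentPairs N k * k ≤ suc N * (suc N + k)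
congruentPairs*k≤ N k = begin
  congruentPairs N k * k                              ≡⟨ sumBelow-*ʳ (suc N) k _ ⟨
  ∑[ a < suc N ] (congruentBelow k a (suc N) * k)     ≤⟨ sumBelow-mono-≤ (suc N) (λ a _ → congruentBelow*k≤ k a (suc N)) ⟩
  ∑[ a < suc N ] (suc N + k)                          ≡⟨ sumBelow-const (suc N) _ ⟩
  suc N * (suc N + k)                                 ∎
  where open ≤-Reasoning

[m*n]^o≡m^o*n^o : ∀ m n o → (m * n) ^ o ≡ m ^ o * n ^ o
[m*n]^o≡m^o*n^o m n zero    = refl
[m*n]^o≡m^o*n^o m n (suc o) = trans (cong (m * n *_) ([m*n]^o≡m^o*n^o m n o)) (interchange m n (m ^ o) (n ^ o))
  where
  interchange : ∀ a b x y → a * b * (x * y) ≡ a * x * (b * y)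
  interchange = solve-∀

*-^-mono-≤ : ∀ {a b p q x y} → a ≤ b → p * a ^ x ≤ q * b ^ y → ∀ n → p * a ^ (n + x) ≤ q * b ^ (n + y)
*-^-mono-≤ a≤b base zero    = base
*-^-mono-≤ {a} {b} {p} {q} {x} {y} a≤b base (suc n) = begin
  p * (a * a ^ (n + x))   ≡⟨ swap p a _ ⟩
  a * (p * a ^ (n + x))   ≤⟨ *-mono-≤ a≤b (*-^-mono-≤ {p = p} {q} {x} {y} a≤b base n) ⟩
  b * (q * b ^ (n + y))   ≡⟨ swap b q _ ⟩
  q * (b * b ^ (n + y))   ∎
  where
  open ≤-Reasoning
  swap : ∀ p a z → p * (a * z) ≡ a * (p * z)
  swap = solve-∀

8*11^d≤20^d : ∀ d → 4 ≤ d → 8 * 11 ^ d ≤ 20 ^ d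
8*11^d≤20^d d 4≤d = ≤-trans
  (subst (λ d → 8 * 11 ^ d ≤ 1 * 20 ^ d) (m∸n+n≡m 4≤d)
    (*-^-mono-≤ {p = 8} {q = 1} {x = 4} {y = 4} (≤ᵇ⇒≤ 11 20 _) (≤ᵇ⇒≤ (8 * 11 ^ 4) (1 * 20 ^ 4) _) (d ∸ 4)))
  (≤-reflexive (*-identityˡ (20 ^ d)))

8*2^d≤5^d : ∀ d → 3 ≤ d → 8 * 2 ^ d ≤ 5 ^ d
8*2^d≤5^d d 3≤d = ≤-trans
  (subst (λ d → 8 * 2 ^ d ≤ 1 * 5 ^ d) (m∸n+n≡m 3≤d)
    (*-^-mono-≤ {p = 8} {q = 1} {x = 3} {y = 3} (≤ᵇ⇒≤ 2 5 _) (≤ᵇ⇒≤ (8 * 2 ^ 3) (1 * 5 ^ 3) _) (d ∸ 3)))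
  (≤-reflexive (*-identityˡ (5 ^ d)))

8*2^[2+e]≤3*4^e : ∀ e → 4 ≤ e → 8 * 2 ^ (2 + e) ≤ 3 * 4 ^ e
8*2^[2+e]≤3*4^e e 4≤e = subst (λ e → 8 * 2 ^ (2 + e) ≤ 3 * 4 ^ e) (m∸n+n≡m 4≤e)
  (subst (λ z → 8 * 2 ^ z ≤ 3 * 4 ^ (e ∸ 4 + 4)) (shift (e ∸ 4))
    (*-^-mono-≤ {p = 8} {q = 3} {x = 6} {y = 4} (≤ᵇ⇒≤ 2 4 _) (≤ᵇ⇒≤ (8 * 2 ^ 6) (3 * 4 ^ 4) _) (e ∸ 4)))
  where
  shift : ∀ n → n + 6 ≡ 2 + (n + 4)
  shift = solve-∀

-- ∑_{j<n} 1/((3+j)(4+j)) = 1/3 - 1/(3+n) = n/(3(3+n)).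
telescoping : ∀ n (y : ℕ → ℕ) Q P → (∀ j → j < n → y j * ((3 + j) * (4 + j)) * Q ≤ P) →
              3 * (3 + n) * Q * ∑[ j < n ] y j ≤ n * P
telescoping zero    y Q P _ = ≤-reflexive (*-zeroʳ (3 * 3 * Q))
telescoping (suc n) y Q P bound = *-cancelˡ-≤ (3 + n) (begin
  (3 + n) * (3 * (4 + n) * Q * (total + y n))                        ≡⟨ split n Q total (y n) ⟩
  (4 + n) * (3 * (3 + n) * Q * total) + 3 * (y n * ((3 + n) * (4 + n)) * Q)
    ≤⟨ +-mono-≤ (*-monoʳ-≤ (4 + n) (telescoping n y Q P (λ j j<n → bound j (m<n⇒m<1+n j<n))))
                (*-monoʳ-≤ 3 (bound n ≤-refl)) ⟩
  (4 + n) * (n * P) + 3 * P                                      ≡⟨ factor n P ⟩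
  (3 + n) * (suc n * P)                                          ∎)
  where
  open ≤-Reasoning
  total = ∑[ j < n ] y j
  split : ∀ n q s t → (3 + n) * (3 * (4 + n) * q * (s + t)) ≡ (4 + n) * (3 * (3 + n) * q * s) + 3 * (t * ((3 + n) * (4 + n)) * q)
  split = solve-∀
  factor : ∀ n p → (4 + n) * (n * p) + 3 * p ≡ (3 + n) * ((1 + n) * p)
  factor = solve-∀

invisibleCount : ℕ → ℕ → ℕ
invisibleCount d N = sumPairs d N (λ v w → 𝟙ᶜ (visible? (v , w)))

invisibleCount≤ : ∀ d N → invisibleCount d N ≤
                  congruentPairs N 2 ^ d + congruentPairs N 3 ^ d + ∑[ j < N ∸ 3 ] (congruentPairs N (4 + j) ^ d)
invisibleCount≤ d N = begin
  invisibleCount d N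
    ≤⟨ sumPairs-mono-≤ d N 𝟙ᶜvisible≤ ⟩
  sumPairs d N (λ v w → allCongruent 2 v w + allCongruent 3 v w + ∑[ j < N ∸ 3 ] allCongruent (4 + j) v w)
    ≡⟨ trans (sumPairs-+ d N _ _) (cong (_+ sumPairs d N (λ v w → ∑[ j < N ∸ 3 ] allCongruent (4 + j) v w)) (sumPairs-+ d N _ _)) ⟩
  sumPairs d N (allCongruent 2) + sumPairs d N (allCongruent 3) + sumPairs d N (λ v w → ∑[ j < N ∸ 3 ] allCongruent (4 + j) v w)
    ≡⟨ cong₂ _+_ (cong₂ _+_ (sumPairs-coordinatewiseProduct d N _) (sumPairs-coordinatewiseProduct d N _))
                 (trans (sumPairs-sumBelow d N (N ∸ 3) (λ j → allCongruent (4 + j)))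
                        (sumBelow-cong (N ∸ 3) (λ j _ → sumPairs-coordinatewiseProduct d N _))) ⟩
  congruentPairs N 2 ^ d + congruentPairs N 3 ^ d + ∑[ j < N ∸ 3 ] (congruentPairs N (4 + j) ^ d) ∎
  where open ≤-Reasoning

8*c^d≤m^d : ∀ {c m} r s d .{{_ : NonZero r}} → r * c ≤ s * m → 8 * s ^ d ≤ r ^ d → 8 * c ^ d ≤ m ^ d
8*c^d≤m^d {c} {m} r s d rc≤sm 8sᵈ≤rᵈ = *-cancelˡ-≤ (r ^ d) {{m^n≢0 r d}} (begin
  r ^ d * (8 * c ^ d)      ≡⟨ swap (r ^ d) (c ^ d) ⟩
  8 * (r ^ d * c ^ d)      ≡⟨ cong (8 *_) ([m*n]^o≡m^o*n^o r c d) ⟨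
  8 * (r * c) ^ d          ≤⟨ *-monoʳ-≤ 8 (^-monoˡ-≤ d rc≤sm) ⟩
  8 * (s * m) ^ d          ≡⟨ cong (8 *_) ([m*n]^o≡m^o*n^o s m d) ⟩
  8 * (s ^ d * m ^ d)      ≡⟨ *-assoc 8 (s ^ d) _ ⟨
  8 * s ^ d * m ^ d        ≤⟨ *-monoˡ-≤ (m ^ d) 8sᵈ≤rᵈ ⟩
  r ^ d * m ^ d            ∎)
  where
  open ≤-Reasoning
  swap : ∀ a b → a * (8 * b) ≡ 8 * (a * b)
  swap = solve-∀

congruentPairs*k≤2*M² : ∀ N k .{{_ : NonZero k}} → k ≤ suc N → congruentPairs N k * k ≤ 2 * (suc N * suc N)
congruentPairs*k≤2*M² N k k≤M = begin
  congruentPairs N k * k       ≤⟨ congruentPairs*k≤ N k ⟩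
  suc N * (suc N + k)          ≤⟨ *-monoʳ-≤ (suc N) (+-monoʳ-≤ (suc N) k≤M) ⟩
  suc N * (suc N + suc N)      ≡⟨ double (suc N) ⟩
  2 * (suc N * suc N)          ∎
  where
  open ≤-Reasoning
  double : ∀ m → m * (m + m) ≡ 2 * (m * m)
  double = solve-∀

module _ {N : ℕ} (19≤N : 19 ≤ N) where

  private
    M  = suc N
    M² = M * M

  20*congruentPairs₂≤11*M² : 20 * congruentPairs N 2 ≤ 11 * M²
  20*congruentPairs₂≤11*M² = begin
    20 * congruentPairs N 2            ≡⟨ regroup (congruentPairs N 2) ⟩
    10 * (congruentPairs N 2 * 2)      ≤⟨ *-monoʳ-≤ 10 (congruentPairs*k≤ N 2) ⟩
    10 * (M * (M + 2))                 ≡⟨ expand M ⟩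
    10 * M² + 20 * M                   ≤⟨ +-monoʳ-≤ (10 * M²) (*-monoˡ-≤ M (s≤s 19≤N)) ⟩
    10 * M² + M²                       ≡⟨ +-comm (10 * M²) M² ⟩
    11 * M²                            ∎
    where
    open ≤-Reasoning
    regroup : ∀ c → 20 * c ≡ 10 * (c * 2)
    regroup = solve-∀
    expand : ∀ m → 10 * (m * (m + 2)) ≡ 10 * (m * m) + 20 * m
    expand = solve-∀

  5*congruentPairs₃≤2*M² : 5 * congruentPairs N 3 ≤ 2 * M²
  5*congruentPairs₃≤2*M² = *-cancelˡ-≤ {5 * congruentPairs N 3} {2 * M²} 12 (begin
    12 * (5 * congruentPairs N 3)      ≡⟨ regroup (congruentPairs N 3) ⟩
    20 * (congruentPairs N 3 * 3)      ≤⟨ *-monoʳ-≤ 20 (congruentPairs*k≤ N 3) ⟩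
    20 * (M * (M + 3))                 ≡⟨ expand M ⟩
    20 * M² + 3 * (20 * M)             ≤⟨ +-monoʳ-≤ (20 * M²) (*-monoʳ-≤ 3 (*-monoˡ-≤ M (s≤s 19≤N))) ⟩
    20 * M² + 3 * M²                   ≤⟨ +-monoʳ-≤ (20 * M²) (*-monoˡ-≤ M² (n≤1+n 3)) ⟩
    20 * M² + 4 * M²                   ≡⟨ collect M² ⟩
    12 * (2 * M²)                      ∎)
    where
    open ≤-Reasoning
    regroup : ∀ c → 12 * (5 * c) ≡ 20 * (c * 3)
    regroup = solve-∀
    expand : ∀ m → 20 * (m * (m + 3)) ≡ 20 * (m * m) + 3 * (20 * m)
    expand = solve-∀
    collect : ∀ x → 20 * x + 4 * x ≡ 12 * (2 * x)
    collect = solve-∀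

  -- Termwise (congruentPairs N k)ᵈ ≤ (2M²/k)ᵈ ≤ (2M²)ᵈ / (4ᵉ (k-1) k) for d = 2 + e, then telescope over k.
  8*∑congruentPairs^d≤M²^d : ∀ e → 4 ≤ e → 8 * ∑[ j < N ∸ 3 ] (congruentPairs N (4 + j) ^ (2 + e)) ≤ M² ^ (2 + e)
  8*∑congruentPairs^d≤M²^d e 4≤e = *-cancelˡ-≤ {8 * total} {M² ^ d} (3 * 4 ^ e) {{m*n≢0 3 (4 ^ e) {{_}} {{m^n≢0 4 e}}}} (begin
    3 * 4 ^ e * (8 * total)          ≡⟨ swap (3 * 4 ^ e) total ⟩
    8 * (3 * 4 ^ e * total)          ≤⟨ *-monoʳ-≤ 8 (*-cancelˡ-≤ {3 * 4 ^ e * total} {P} (3 + n) (begin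
                                      (3 + n) * (3 * 4 ^ e * total)  ≡⟨ regroup n (4 ^ e) total ⟩
                                      3 * (3 + n) * 4 ^ e * total    ≤⟨ telescoping n (λ j → congruentPairs N (4 + j) ^ d) (4 ^ e) P termwise ⟩
                                      n * P                      ≤⟨ *-monoˡ-≤ P (m≤n+m n 3) ⟩
                                      (3 + n) * P                ∎)) ⟩
    8 * (2 ^ d * M² ^ d)         ≡⟨ *-assoc 8 (2 ^ d) _ ⟨
    8 * 2 ^ d * M² ^ d           ≤⟨ *-monoˡ-≤ (M² ^ d) (8*2^[2+e]≤3*4^e e 4≤e) ⟩
    3 * 4 ^ e * M² ^ d           ∎)
    where
    open ≤-Reasoning
    d = 2 + e
    n = N ∸ 3
    total = ∑[ j < n ] (congruentPairs N (4 + j) ^ d)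
    P = 2 ^ d * M² ^ d
    swap : ∀ a b → a * (8 * b) ≡ 8 * (a * b)
    swap = solve-∀
    regroup : ∀ n q s → (3 + n) * (3 * q * s) ≡ 3 * (3 + n) * q * s
    regroup = solve-∀
    termwise : ∀ j → j < n → congruentPairs N (4 + j) ^ d * ((3 + j) * (4 + j)) * 4 ^ e ≤ P
    termwise j j<n = begin
      c ^ d * ((3 + j) * (4 + j)) * 4 ^ e      ≡⟨ *-assoc (c ^ d) _ _ ⟩
      c ^ d * ((3 + j) * (4 + j) * 4 ^ e)
        ≤⟨ *-monoʳ-≤ (c ^ d) (*-mono-≤ (*-monoˡ-≤ (4 + j) (n≤1+n (3 + j))) (^-monoˡ-≤ e (m≤m+n 4 j))) ⟩
      c ^ d * ((4 + j) * (4 + j) * (4 + j) ^ e) ≡⟨ cong (c ^ d *_) (*-assoc (4 + j) (4 + j) ((4 + j) ^ e)) ⟩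
      c ^ d * (4 + j) ^ d                      ≡⟨ [m*n]^o≡m^o*n^o c (4 + j) d ⟨
      (c * (4 + j)) ^ d                        ≤⟨ ^-monoˡ-≤ d (congruentPairs*k≤2*M² N (4 + j) (m≤n⇒m≤1+n 4+j≤N)) ⟩
      (2 * M²) ^ d                             ≡⟨ [m*n]^o≡m^o*n^o 2 M² d ⟩
      P                                        ∎
      where
      c = congruentPairs N (4 + j)
      4+j≤N : 4 + j ≤ N
      4+j≤N = subst (4 + j ≤_) (m+[n∸m]≡n (≤-trans (≤ᵇ⇒≤ 3 19 _) 19≤N)) (+-monoʳ-≤ 3 j<n)

  2*invisibleCount≤pairCount : ∀ d → 6 ≤ d → 2 * invisibleCount d N ≤ pairCount d N
  2*invisibleCount≤pairCount d 6≤d = *-cancelˡ-≤ {2 * invisibleCount d N} {pairCount d N} 8 (begin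
    8 * (2 * invisibleCount d N)        ≡⟨ swap (invisibleCount d N) ⟩
    2 * (8 * invisibleCount d N)        ≤⟨ *-monoʳ-≤ 2 (*-monoʳ-≤ 8 (invisibleCount≤ d N)) ⟩
    2 * (8 * (c₂ + c₃ + c₄₊))           ≡⟨ distrib c₂ c₃ c₄₊ ⟩
    2 * (8 * c₂ + 8 * c₃ + 8 * c₄₊)     ≤⟨ *-monoʳ-≤ 2 (+-mono-≤ (+-mono-≤ bound₂ bound₃) bound₄₊) ⟩
    2 * (M² ^ d + M² ^ d + M² ^ d)      ≤⟨ triple (M² ^ d) ⟩
    8 * M² ^ d                          ≡⟨ cong (8 *_) ([m*n]^o≡m^o*n^o M M d) ⟩
    8 * pairCount d N                   ∎)
    where
    open ≤-Reasoning
    c₂ = congruentPairs N 2 ^ d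
    c₃ = congruentPairs N 3 ^ d
    c₄₊ = ∑[ j < N ∸ 3 ] (congruentPairs N (4 + j) ^ d)
    swap : ∀ x → 8 * (2 * x) ≡ 2 * (8 * x)
    swap = solve-∀
    distrib : ∀ a b c → 2 * (8 * (a + b + c)) ≡ 2 * (8 * a + 8 * b + 8 * c)
    distrib = solve-∀
    triple : ∀ x → 2 * (x + x + x) ≤ 8 * x
    triple x = subst (_≤ 8 * x) (six x) (*-monoˡ-≤ x (≤ᵇ⇒≤ 6 8 _))
      where
      six : ∀ x → 6 * x ≡ 2 * (x + x + x)
      six = solve-∀
    bound₂ : 8 * c₂ ≤ M² ^ d
    bound₂ = 8*c^d≤m^d 20 11 d 20*congruentPairs₂≤11*M² (8*11^d≤20^d d (≤-trans (≤ᵇ⇒≤ 4 6 _) 6≤d))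
    bound₃ : 8 * c₃ ≤ M² ^ d
    bound₃ = 8*c^d≤m^d 5 2 d 5*congruentPairs₃≤2*M² (8*2^d≤5^d d (≤-trans (≤ᵇ⇒≤ 3 6 _) 6≤d))
    bound₄₊ : 8 * c₄₊ ≤ M² ^ d
    bound₄₊ = subst (λ d → 8 * ∑[ j < N ∸ 3 ] (congruentPairs N (4 + j) ^ d) ≤ M² ^ d) (m+[n∸m]≡n (≤-trans (≤ᵇ⇒≤ 2 6 _) 6≤d))
                    (8*∑congruentPairs^d≤M²^d (d ∸ 2) (∸-monoˡ-≤ 2 6≤d))

-- Rational arithmetic

ℕ→ℚ≡mkℚ : ∀ n → ℕ→ℚ n ≡ mkℚ (ℤ.+ n) 0 (Coprimality.sym (Coprimality.1-coprimeTo n))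
ℕ→ℚ≡mkℚ n = ℚ.↥p/↧p≡p (mkℚ (ℤ.+ n) 0 (Coprimality.sym (Coprimality.1-coprimeTo n)))

ℕ→ℚ-homo-+ : ∀ m n → ℕ→ℚ (m + n) ≡ ℕ→ℚ m +ℚ ℕ→ℚ n
ℕ→ℚ-homo-+ m n rewrite ℕ→ℚ≡mkℚ m | ℕ→ℚ≡mkℚ n =
  cong (λ i → i ℚ./ 1) (sym (cong₂ ℤ._+_ (ℤ.*-identityʳ (ℤ.+ m)) (ℤ.*-identityʳ (ℤ.+ n))))

ℕ→ℚ-homo-* : ∀ m n → ℕ→ℚ (m * n) ≡ ℕ→ℚ m *ℚ ℕ→ℚ n
ℕ→ℚ-homo-* m n rewrite ℕ→ℚ≡mkℚ m | ℕ→ℚ≡mkℚ n = cong (λ i → i ℚ./ 1) (ℤ.pos-* m n)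

ℕ→ℚ-mono-≤ : ∀ {m n} → m ≤ n → ℕ→ℚ m ≤ℚ ℕ→ℚ n
ℕ→ℚ-mono-≤ {m} {n} m≤n rewrite ℕ→ℚ≡mkℚ m | ℕ→ℚ≡mkℚ n =
  *≤* (subst₂ ℤ._≤_ (sym (ℤ.*-identityʳ (ℤ.+ m))) (sym (ℤ.*-identityʳ (ℤ.+ n))) (ℤ.+≤+ m≤n))

ℕ→ℚ-mono-< : ∀ {m n} → m < n → ℕ→ℚ m <ℚ ℕ→ℚ n
ℕ→ℚ-mono-< {m} {n} m<n rewrite ℕ→ℚ≡mkℚ m | ℕ→ℚ≡mkℚ n =
  *<* (subst₂ ℤ._<_ (sym (ℤ.*-identityʳ (ℤ.+ m))) (sym (ℤ.*-identityʳ (ℤ.+ n))) (ℤ.+<+ m<n))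

[m/n]*n≡m : ∀ m n → (divℚ m (suc n)) *ℚ ℕ→ℚ (suc n) ≡ ℕ→ℚ m
[m/n]*n≡m m n rewrite ℕ→ℚ≡mkℚ (suc n) | ℕ→ℚ≡mkℚ m = ℚ.toℚᵘ-injective
  (ℚᵘ.≃-trans (ℚ.toℚᵘ-homo-* (divℚ m (suc n)) (ℚ.mkℚ (ℤ.+ suc n) 0 _))
  (ℚᵘ.≃-trans (ℚᵘ.*-cong (ℚ.toℚᵘ-fromℚᵘ (ℚᵘ.mkℚᵘ (ℤ.+ m) n)) ℚᵘ.≃-refl)
  (ℚᵘ.*≡* (trans (ℤ.*-identityʳ _) (cong (λ k → ℤ.+ m ℤ.* ℤ.+ suc k) (sym (*-identityʳ n)))))))

ℕ→ℚ-∣-∣² : ∀ m n → ℕ→ℚ ∣ m - n ∣ *ℚ ℕ→ℚ ∣ m - n ∣ ≡ (ℕ→ℚ m - ℕ→ℚ n) *ℚ (ℕ→ℚ m - ℕ→ℚ n)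
ℕ→ℚ-∣-∣² m n with ≤-total m n
... | inj₁ m≤n with m≤n⇒∃[o]m+o≡n m≤n
...   | o , refl rewrite ∣m-m+n∣≡n m o | ℕ→ℚ-homo-+ m o =
  solve 2 (λ M O → O :* O := (M :- (M :+ O)) :* (M :- (M :+ O))) refl (ℕ→ℚ m) (ℕ→ℚ o)
ℕ→ℚ-∣-∣² m n | inj₂ n≤m with m≤n⇒∃[o]m+o≡n n≤m
...   | o , refl rewrite ∣-∣-comm (n + o) n | ∣m-m+n∣≡n n o | ℕ→ℚ-homo-+ n o =
  solve 2 (λ N O → O :* O := ((N :+ O) :- N) :* ((N :+ O) :- N)) refl (ℕ→ℚ n) (ℕ→ℚ o)

archimedean : ∀ ε → 0ℚ <ℚ ε → Σ ℕ (λ K → 1ℚ ≤ℚ ℕ→ℚ K *ℚ ε)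
archimedean (mkℚ +0         _ _) 0<ε = ⊥-elim (ℤ.Positive.pos (ℚ.positive 0<ε))
archimedean (mkℚ -[1+ _ ]   _ _) 0<ε = ⊥-elim (ℤ.Positive.pos (ℚ.positive 0<ε))
archimedean ε@(mkℚ +[1+ m ] d _) _   = suc d , 1≤[1+d]*ε
  where
  1≤[1+d]*ε : 1ℚ ≤ℚ ℕ→ℚ (suc d) *ℚ ε
  1≤[1+d]*ε rewrite ℕ→ℚ≡mkℚ (suc d) =
    ℚ.toℚᵘ-cancel-≤ (ℚᵘ.≤-respʳ-≃ (ℚᵘ.≃-sym (ℚ.toℚᵘ-homo-* [1+d] ε)) (ℚᵘ.*≤* cross))
    where
    [1+d] = mkℚ (ℤ.+ suc d) 0 (Coprimality.sym (Coprimality.1-coprimeTo (suc d)))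
    cross : ℤ.+ 1 ℤ.* ℤ.+ suc (d + 0 * suc d) ℤ.≤ (ℤ.+ suc d ℤ.* +[1+ m ]) ℤ.* ℤ.+ 1
    cross = subst₂ ℤ._≤_ (sym (trans (ℤ.*-identityˡ _) (cong (λ k → ℤ.+ suc k) (+-identityʳ d))))
                         (sym (trans (ℤ.*-identityʳ _) (sym (ℤ.pos-* (suc d) (suc m)))))
                         (ℤ.+≤+ (m≤m*n (suc d) (suc m)))

0≤p*p : ∀ p → 0ℚ ≤ℚ p *ℚ p
0≤p*p p with ℚ.≤-total 0ℚ p
... | inj₁ 0≤p = ℚ.nonNegative⁻¹ (p *ℚ p) {{ℚ.nonNeg*nonNeg⇒nonNeg p {{ℚ.nonNegative 0≤p}} p {{ℚ.nonNegative 0≤p}}}}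
... | inj₂ p≤0 = ℚ.nonNegative⁻¹ (p *ℚ p) {{ℚ.nonPos*nonPos⇒nonPos p {{ℚ.nonPositive p≤0}} p {{ℚ.nonPositive p≤0}}}}

-- With u = x + 1/6, t = u - ε² and h = x - 1/6 one has t² + ε²(u + t) = h² + (2/3)x, and
-- h² = (6x-1)²/36 ≤ ε²/36 ≤ ε²(u + t) as soon as t ≥ 0.
inBand-criterion : ∀ ε x k → 0ℚ ≤ℚ x → 1ℚ ≤ℚ k *ℚ ε →
                   (k *ℚ (ℕ→ℚ 6 *ℚ x - 1ℚ)) *ℚ (k *ℚ (ℕ→ℚ 6 *ℚ x - 1ℚ)) ≤ℚ 1ℚ → InBand ε x
inBand-criterion ε x k 0≤x 1≤kε k²y²≤1 with x +ℚ divℚ 1 6 - ε *ℚ ε ℚ.<? 0ℚ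
... | yes t<0 = inj₁ t<0
... | no  t≮0 = inj₂ (begin
  t *ℚ t                                 ≡⟨ solve 2 (λ T W → T :* T := (T :* T :+ W) :- W) refl t w ⟩
  (t *ℚ t +ℚ w) - w
    ≡⟨ cong (_- w) (solve 3 (λ X C E → ((X :+ C) :- E) :* ((X :+ C) :- E) :+ E :* ((X :+ C) :+ ((X :+ C) :- E))
                                     := (X :- C) :* (X :- C) :+ (C :+ C :+ C :+ C) :* X) refl x ⅙ e) ⟩
  (h *ℚ h +ℚ divℚ 2 3 *ℚ x) - w           ≤⟨ ℚ.+-monoˡ-≤ (ℚ.- w) (ℚ.+-monoˡ-≤ (divℚ 2 3 *ℚ x) h²≤w) ⟩
  (w +ℚ divℚ 2 3 *ℚ x) - w                ≡⟨ solve 2 (λ W Z → (W :+ Z) :- W := Z) refl w (divℚ 2 3 *ℚ x) ⟩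
  divℚ 2 3 *ℚ x                           ∎)
  where
  open ℚ.≤-Reasoning
  ⅙ = divℚ 1 6
  e = ε *ℚ ε
  u = x +ℚ ⅙
  t = u - e
  y = ℕ→ℚ 6 *ℚ x - 1ℚ
  h = x - ⅙
  w = e *ℚ (u +ℚ t)
  0≤e : 0ℚ ≤ℚ e
  0≤e = 0≤p*p ε
  1≤[kε]² : 1ℚ ≤ℚ (k *ℚ ε) *ℚ (k *ℚ ε)
  1≤[kε]² = begin
    1ℚ                                   ≤⟨ 1≤kε ⟩
    k *ℚ ε                               ≡⟨ ℚ.*-identityˡ (k *ℚ ε) ⟨
    1ℚ *ℚ (k *ℚ ε)                       ≤⟨ ℚ.*-monoʳ-≤-nonNeg (k *ℚ ε) {{ℚ.nonNegative (ℚ.≤-trans (ℚ.nonNegative⁻¹ 1ℚ) 1≤kε)}} 1≤kε ⟩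
    (k *ℚ ε) *ℚ (k *ℚ ε)                 ∎
  y²≤e : y *ℚ y ≤ℚ e
  y²≤e = begin
    y *ℚ y                               ≡⟨ solve 1 (λ Y → Y :* Y := con 1ℚ :* (Y :* Y)) refl y ⟩
    1ℚ *ℚ (y *ℚ y)                       ≤⟨ ℚ.*-monoʳ-≤-nonNeg (y *ℚ y) {{ℚ.nonNegative (0≤p*p y)}} 1≤[kε]² ⟩
    ((k *ℚ ε) *ℚ (k *ℚ ε)) *ℚ (y *ℚ y)
      ≡⟨ solve 3 (λ K E Y → ((K :* E) :* (K :* E)) :* (Y :* Y) := ((K :* Y) :* (K :* Y)) :* (E :* E)) refl k ε y ⟩
    ((k *ℚ y) *ℚ (k *ℚ y)) *ℚ e          ≤⟨ ℚ.*-monoʳ-≤-nonNeg e {{ℚ.nonNegative 0≤e}} k²y²≤1 ⟩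
    1ℚ *ℚ e                              ≡⟨ ℚ.*-identityˡ e ⟩
    e                                    ∎
  h²≤w : h *ℚ h ≤ℚ w
  h²≤w = begin
    h *ℚ h
      ≡⟨ solve 1 (λ X → (X :- con ⅙) :* (X :- con ⅙)
                      := (con ⅙ :* con ⅙) :* ((con (ℕ→ℚ 6) :* X :- con 1ℚ) :* (con (ℕ→ℚ 6) :* X :- con 1ℚ))) refl x ⟩
    (⅙ *ℚ ⅙) *ℚ (y *ℚ y)                 ≤⟨ ℚ.*-monoˡ-≤-nonNeg (⅙ *ℚ ⅙) {{_}} y²≤e ⟩
    (⅙ *ℚ ⅙) *ℚ e                        ≤⟨ ℚ.*-monoʳ-≤-nonNeg e {{ℚ.nonNegative 0≤e}} (toWitness {a? = ⅙ *ℚ ⅙ ℚ.≤? ⅙} _) ⟩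
    ⅙ *ℚ e                               ≡⟨ ℚ.*-comm ⅙ e ⟩
    e *ℚ ⅙                               ≤⟨ ℚ.*-monoˡ-≤-nonNeg e {{ℚ.nonNegative 0≤e}} ⅙≤u+t ⟩
    w                                    ∎
    where
    ⅙≤u+t : ⅙ ≤ℚ u +ℚ t
    ⅙≤u+t = begin
      ⅙                                  ≡⟨ solve 1 (λ C → C := (con 0ℚ :+ C) :+ con 0ℚ) refl ⅙ ⟩
      (0ℚ +ℚ ⅙) +ℚ 0ℚ                    ≤⟨ ℚ.+-mono-≤ (ℚ.+-monoˡ-≤ ⅙ 0≤x) (ℚ.≮⇒≥ t≮0) ⟩
      u +ℚ t                             ∎

K*∣6s-D∣≤D⇒[K[6x-1]]²≤1 : ∀ K s D′ → K * ∣ 6 * s - suc D′ ∣ ≤ suc D′ →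
                          (ℕ→ℚ K *ℚ (ℕ→ℚ 6 *ℚ (divℚ s (suc D′)) - 1ℚ)) *ℚ (ℕ→ℚ K *ℚ (ℕ→ℚ 6 *ℚ (divℚ s (suc D′)) - 1ℚ)) ≤ℚ 1ℚ
K*∣6s-D∣≤D⇒[K[6x-1]]²≤1 K s D′ K*δ≤D = ℚ.*-cancelˡ-≤-pos (D *ℚ D) {{D²>0}} (begin
  (D *ℚ D) *ℚ ((k *ℚ (ℕ→ℚ 6 *ℚ x - 1ℚ)) *ℚ (k *ℚ (ℕ→ℚ 6 *ℚ x - 1ℚ)))
    ≡⟨ solve 4 (λ D K C X → (D :* D) :* ((K :* (C :* X :- con 1ℚ)) :* (K :* (C :* X :- con 1ℚ)))
                        := (K :* K) :* ((C :* (X :* D) :- D) :* (C :* (X :* D) :- D))) refl D k (ℕ→ℚ 6) x ⟩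
  (k *ℚ k) *ℚ ((ℕ→ℚ 6 *ℚ (x *ℚ D) - D) *ℚ (ℕ→ℚ 6 *ℚ (x *ℚ D) - D))
    ≡⟨ cong (λ z → (k *ℚ k) *ℚ ((ℕ→ℚ 6 *ℚ z - D) *ℚ (ℕ→ℚ 6 *ℚ z - D))) ([m/n]*n≡m s D′) ⟩
  (k *ℚ k) *ℚ ((ℕ→ℚ 6 *ℚ ℕ→ℚ s - D) *ℚ (ℕ→ℚ 6 *ℚ ℕ→ℚ s - D))
    ≡⟨ cong (λ z → (k *ℚ k) *ℚ ((z - D) *ℚ (z - D))) (ℕ→ℚ-homo-* 6 s) ⟨
  (k *ℚ k) *ℚ ((ℕ→ℚ (6 * s) - D) *ℚ (ℕ→ℚ (6 * s) - D))
    ≡⟨ cong ((k *ℚ k) *ℚ_) (ℕ→ℚ-∣-∣² (6 * s) (suc D′)) ⟨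
  (k *ℚ k) *ℚ (ℕ→ℚ δ *ℚ ℕ→ℚ δ)
    ≡⟨ solve 2 (λ K E → (K :* K) :* (E :* E) := (K :* E) :* (K :* E)) refl k (ℕ→ℚ δ) ⟩
  (k *ℚ ℕ→ℚ δ) *ℚ (k *ℚ ℕ→ℚ δ)
    ≡⟨ trans (ℕ→ℚ-homo-* (K * δ) (K * δ)) (cong₂ _*ℚ_ (ℕ→ℚ-homo-* K δ) (ℕ→ℚ-homo-* K δ)) ⟨
  ℕ→ℚ ((K * δ) * (K * δ))     ≤⟨ ℕ→ℚ-mono-≤ (*-mono-≤ K*δ≤D K*δ≤D) ⟩
  ℕ→ℚ (suc D′ * suc D′)           ≡⟨ ℕ→ℚ-homo-* (suc D′) (suc D′) ⟩
  D *ℚ D                            ≡⟨ ℚ.*-identityʳ (D *ℚ D) ⟨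
  (D *ℚ D) *ℚ 1ℚ                    ∎)
  where
  open ℚ.≤-Reasoning
  D = ℕ→ℚ (suc D′)
  k = ℕ→ℚ K
  x = divℚ s (suc D′)
  δ = ∣ 6 * s - suc D′ ∣
  D>0 : ℚ.Positive D
  D>0 = ℚ.positive (ℕ→ℚ-mono-< {0} {suc D′} (s≤s z≤n))
  D²>0 : ℚ.Positive (D *ℚ D)
  D²>0 = ℚ.pos*pos⇒pos D {{D>0}} D {{D>0}}

K*∣6s-D∣≤D⇒inBand : ∀ ε K s D → 0 < D → 1ℚ ≤ℚ ℕ→ℚ K *ℚ ε → K * ∣ 6 * s - D ∣ ≤ D → InBand ε (divℚ s D)
K*∣6s-D∣≤D⇒inBand ε K s (suc D′) _ 1≤Kε K*δ≤D =
  inBand-criterion ε (divℚ s (suc D′)) (ℕ→ℚ K) (ℚ.nonNegative⁻¹ (divℚ s (suc D′)) {{ℚ.normalize-nonNeg s (suc D′)}}) 1≤Kε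
                   (K*∣6s-D∣≤D⇒[K[6x-1]]²≤1 K s D′ K*δ≤D)

1-ε-fraction : ∀ ε K g b → 0ℚ ≤ℚ ε → 1ℚ ≤ℚ ℕ→ℚ K *ℚ ε → K * b ≤ g + b →
               (1ℚ - ε) *ℚ ℕ→ℚ (g + b) ≤ℚ ℕ→ℚ g
1-ε-fraction ε K g b 0≤ε 1≤Kε K*b≤g+b = begin
  (1ℚ - ε) *ℚ n                 ≡⟨ solve 2 (λ E N → (con 1ℚ :- E) :* N := N :- E :* N) refl ε n ⟩
  n - ε *ℚ n                    ≤⟨ ℚ.+-monoʳ-≤ n (ℚ.neg-antimono-≤ b≤εn) ⟩
  n - ℕ→ℚ b                     ≡⟨ cong (_- ℕ→ℚ b) (ℕ→ℚ-homo-+ g b) ⟩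
  (ℕ→ℚ g +ℚ ℕ→ℚ b) - ℕ→ℚ b      ≡⟨ solve 2 (λ G B → (G :+ B) :- B := G) refl (ℕ→ℚ g) (ℕ→ℚ b) ⟩
  ℕ→ℚ g                         ∎
  where
  open ℚ.≤-Reasoning
  n = ℕ→ℚ (g + b)
  b≤εn : ℕ→ℚ b ≤ℚ ε *ℚ n
  b≤εn = begin
    ℕ→ℚ b                        ≡⟨ ℚ.*-identityˡ (ℕ→ℚ b) ⟨
    1ℚ *ℚ ℕ→ℚ b                  ≤⟨ ℚ.*-monoʳ-≤-nonNeg (ℕ→ℚ b) {{ℚ.nonNegative (ℕ→ℚ-mono-≤ {0} {b} z≤n)}} 1≤Kε ⟩
    (ℕ→ℚ K *ℚ ε) *ℚ ℕ→ℚ b        ≡⟨ solve 3 (λ K E B → (K :* E) :* B := E :* (K :* B)) refl (ℕ→ℚ K) ε (ℕ→ℚ b) ⟩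
    ε *ℚ (ℕ→ℚ K *ℚ ℕ→ℚ b)        ≡⟨ cong (ε *ℚ_) (ℕ→ℚ-homo-* K b) ⟨
    ε *ℚ ℕ→ℚ (K * b)           ≤⟨ ℚ.*-monoˡ-≤-nonNeg ε {{ℚ.nonNegative 0≤ε}} (ℕ→ℚ-mono-≤ K*b≤g+b) ⟩
    ε *ℚ n                       ∎

length-Ω : ∀ d N → length (Ω d N) ≡ sumPairs d N (λ v w → 𝟙 (visible? (v , w)))
length-Ω d N = trans (length-filter≡sumOver-𝟙 (cartesianProduct (grid d N) (grid d N)) visible?)
                     (sumOver-cartesianProduct (grid d N) (grid d N) _)

length-goodPairs : ∀ ε d N → length (goodPairs ε d N) ≡
                   sumPairs d N (λ v w → 𝟙 (visible? (v , w)) * 𝟙 (inBand? ε (distSq d N v w)))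
length-goodPairs ε d N = trans (length-filter≡sumOver-𝟙 (Ω d N) _)
  (trans (sumOver-filter (cartesianProduct (grid d N) (grid d N)) visible? _)
         (sumOver-cartesianProduct (grid d N) (grid d N) _))

module Counting (ε : ℚ) (d N : ℕ) where

  visibleCount goodCount badCount : ℕ
  visibleCount = sumPairs d N (λ v w → 𝟙 (visible? (v , w)))
  goodCount    = sumPairs d N (λ v w → 𝟙 (visible? (v , w)) * 𝟙 (inBand? ε (distSq d N v w)))
  badCount     = sumPairs d N (λ v w → 𝟙 (visible? (v , w)) * 𝟙ᶜ (inBand? ε (distSq d N v w)))

  visibleCount≡good+bad : visibleCount ≡ goodCount + badCount
  visibleCount≡good+bad = trans (sumPairs-cong d N split) (sumPairs-+ d N _ _)
    where
    split : ∀ v w → 𝟙 (visible? (v , w)) ≡ 𝟙 (visible? (v , w)) * 𝟙 (inBand? ε (distSq d N v w))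
                                          + 𝟙 (visible? (v , w)) * 𝟙ᶜ (inBand? ε (distSq d N v w))
    split v w = begin
      𝟙 vis                           ≡⟨ *-identityʳ (𝟙 vis) ⟨
      𝟙 vis * 1                       ≡⟨ cong (𝟙 vis *_) (𝟙+𝟙ᶜ≡1 inBand) ⟨
      𝟙 vis * (𝟙 inBand + 𝟙ᶜ inBand)  ≡⟨ *-distribˡ-+ (𝟙 vis) _ _ ⟩
      𝟙 vis * 𝟙 inBand + 𝟙 vis * 𝟙ᶜ inBand ∎
      where
      open ≡-Reasoning
      vis = visible? (v , w)
      inBand = inBand? ε (distSq d N v w)

  pairCount≡visible+invisible : pairCount d N ≡ visibleCount + invisibleCount d N
  pairCount≡visible+invisible = begin
    pairCount d N                              ≡⟨ *-identityʳ (pairCount d N) ⟨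
    pairCount d N * 1                          ≡⟨ sumPairs-const d N 1 ⟨
    sumPairs d N (λ _ _ → 1)                   ≡⟨ sumPairs-cong d N (λ v w → sym (𝟙+𝟙ᶜ≡1 (visible? (v , w)))) ⟩
    sumPairs d N (λ v w → 𝟙 (visible? (v , w)) + 𝟙ᶜ (visible? (v , w))) ≡⟨ sumPairs-+ d N _ _ ⟩
    visibleCount + invisibleCount d N          ∎
    where open ≡-Reasoning

  pairCount≤2*visibleCount : 19 ≤ N → 6 ≤ d → pairCount d N ≤ 2 * visibleCount
  pairCount≤2*visibleCount 19≤N 6≤d = +-cancelʳ-≤ (pairCount d N) _ _ (begin
    pairCount d N + pairCount d N                              ≡⟨ cong (λ t → t + t) pairCount≡visible+invisible ⟩
    (visibleCount + invisibleCount d N) + (visibleCount + invisibleCount d N) ≡⟨ double visibleCount (invisibleCount d N) ⟩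
    2 * visibleCount + 2 * invisibleCount d N                  ≤⟨ +-monoʳ-≤ (2 * visibleCount) (2*invisibleCount≤pairCount 19≤N d 6≤d) ⟩
    2 * visibleCount + pairCount d N                           ∎)
    where
    open ≤-Reasoning
    double : ∀ a b → (a + b) + (a + b) ≡ 2 * a + 2 * b
    double = solve-∀

  module _ (K : ℕ) (1≤Kε : 1ℚ ≤ℚ ℕ→ℚ K *ℚ ε) (4K≤N : 4 * K ≤ N) where
    open Concentration N

    badCount≤farCount : 1 ≤ d → 1 ≤ N → badCount ≤ sumPairs d N (λ v w → 𝟙 (farFromMean? K v w))
    badCount≤farCount 1≤d 1≤N = sumPairs-mono-≤ d N (λ v w _ _ → pointwise v w)
      where
      pointwise : ∀ v w → 𝟙 (visible? (v , w)) * 𝟙ᶜ (inBand? ε (distSq d N v w)) ≤ 𝟙 (farFromMean? K v w)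
      pointwise v w with farFromMean? K v w | inBand? ε (distSq d N v w)
      ... | yes _    | inBand?  = *-mono-≤ (𝟙≤1 (visible? (v , w))) (𝟙ᶜ≤1 inBand?)
      ... | no  _    | yes _    = ≤-reflexive (*-zeroʳ (𝟙 (visible? (v , w))))
      ... | no  near | no  ¬inBand = ⊥-elim (¬inBand (K*∣6s-D∣≤D⇒inBand ε K (sqDist v w) (N * N * d)
                                       (*-mono-≤ (*-mono-≤ 1≤N 1≤N) 1≤d) 1≤Kε (¬farFromMean⇒K*∣6s-N²d∣≤N²d K v w 4K≤N near)))

    K*badCount≤visibleCount : 19 ≤ N → 6 ≤ d → 288 * (K * K * K) ≤ d → K * badCount ≤ visibleCount
    K*badCount≤visibleCount 19≤N 6≤d 288K³≤d = *-cancelʳ-≤ (K * badCount) visibleCount d {{>-nonZero 1≤d}} (begin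
      K * badCount * d                          ≤⟨ *-monoˡ-≤ d (*-monoʳ-≤ K (badCount≤farCount 1≤d 1≤N)) ⟩
      K * far * d                               ≡⟨ *-assoc K far d ⟩
      K * (far * d)                             ≤⟨ *-monoʳ-≤ K (d*count-farFromMean≤ K d 1≤d 1≤N) ⟩
      K * (144 * (K * K) * pairCount d N)       ≤⟨ *-monoʳ-≤ K (*-monoʳ-≤ (144 * (K * K)) (pairCount≤2*visibleCount 19≤N 6≤d)) ⟩
      K * (144 * (K * K) * (2 * visibleCount))  ≡⟨ regroup K visibleCount ⟩
      288 * (K * K * K) * visibleCount          ≤⟨ *-monoˡ-≤ visibleCount 288K³≤d ⟩
      d * visibleCount                          ≡⟨ *-comm d visibleCount ⟩
      visibleCount * d                          ∎)
      where
      open ≤-Reasoning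
      far = sumPairs d N (λ v w → 𝟙 (farFromMean? K v w))
      1≤d : 1 ≤ d
      1≤d = ≤-trans (s≤s z≤n) 6≤d
      1≤N : 1 ≤ N
      1≤N = ≤-trans (s≤s z≤n) 19≤N
      regroup : ∀ k v → k * (144 * (k * k) * (2 * v)) ≡ 288 * (k * k * k) * v
      regroup = solve-∀

    goodPairs-dense : 0ℚ ≤ℚ ε → 19 ≤ N → 6 ≤ d → 288 * (K * K * K) ≤ d →
                      (1ℚ - ε) *ℚ ℕ→ℚ (length (Ω d N)) ≤ℚ ℕ→ℚ (length (goodPairs ε d N))
    goodPairs-dense 0≤ε 19≤N 6≤d 288K³≤d =
      subst₂ (λ a b → (1ℚ - ε) *ℚ ℕ→ℚ a ≤ℚ ℕ→ℚ b)
             (sym (trans (length-Ω d N) visibleCount≡good+bad)) (sym (length-goodPairs ε d N))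
             (1-ε-fraction ε K goodCount badCount 0≤ε 1≤Kε
               (subst (K * badCount ≤_) visibleCount≡good+bad (K*badCount≤visibleCount 19≤N 6≤d 288K³≤d)))

threshold : ℕ → ℕ
threshold K = 19 + 4 * K + 288 * (K * K * K)

19≤threshold : ∀ K → 19 ≤ threshold K
19≤threshold K = ≤-trans (m≤m+n 19 (4 * K)) (m≤m+n (19 + 4 * K) (288 * (K * K * K)))

4K≤threshold : ∀ K → 4 * K ≤ threshold K
4K≤threshold K = ≤-trans (m≤n+m (4 * K) 19) (m≤m+n (19 + 4 * K) (288 * (K * K * K)))

288K³≤threshold : ∀ K → 288 * (K * K * K) ≤ threshold K
288K³≤threshold K = m≤n+m (288 * (K * K * K)) (19 + 4 * K)

theorem1 : (ε : ℚ) → 0ℚ <ℚ ε →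
    Σ ℕ (λ C → 3 ≤ C × ((d N : ℕ) → C ≤ d → C * d ≤ N →
    (1ℚ - ε) *ℚ ℕ→ℚ (length (Ω d N)) ≤ℚ ℕ→ℚ (length (goodPairs ε d N))))
theorem1 ε 0<ε = threshold K , ≤-trans (≤ᵇ⇒≤ 3 19 _) (19≤threshold K) , dense
  where
  K = proj₁ (archimedean ε 0<ε)
  1≤Kε = proj₂ (archimedean ε 0<ε)
  dense : (d N : ℕ) → threshold K ≤ d → threshold K * d ≤ N →
          (1ℚ - ε) *ℚ ℕ→ℚ (length (Ω d N)) ≤ℚ ℕ→ℚ (length (goodPairs ε d N))
  dense d N C≤d C*d≤N = Counting.goodPairs-dense ε d N K 1≤Kε (≤-trans (4K≤threshold K) C≤N) (ℚ.<⇒≤ 0<ε)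
                          (≤-trans (19≤threshold K) C≤N) (≤-trans (≤ᵇ⇒≤ 6 19 _) 19≤d) (≤-trans (288K³≤threshold K) C≤d)
    where
    19≤d : 19 ≤ d
    19≤d = ≤-trans (19≤threshold K) C≤d
    C≤N : threshold K ≤ N
    C≤N = ≤-trans (m≤m*n (threshold K) d {{>-nonZero (≤-trans (s≤s z≤n) 19≤d)}}) C*d≤N
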